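{- Let $n\ge 2$, $1\le k\le n$, let $\lambda=(\lambda_1,\dots,\lambda_m)$ be a partition of $n$ with $m$ parts, and let $S$ be a standard Young tableau of shape $\lambda$. Let $$\mathrm{eig}(S)=\frac1n+\frac{2(n-1)}{nk(2n-(k+1))}\sum_{(i,j):\,n-k<S(i,j)\le n}(j-i).$$ Then: (i) $\frac{2-m}{n}\le\mathrm{eig}(S)\le\frac{\lambda_1}{n}$; (ii) if $\lambda_1>\frac{6n}{10}$, then $|\mathrm{eig}(S)|\le 1-\frac{n-1}{n-\frac{k+1}{2}}\cdot\frac{n-\lambda_1}{n}\cdot\frac{\lambda_1+1}{n}$; and if $m>\frac{6n}{10}$, then $|\mathrm{eig}(S)|\le 1-\frac{n-1}{n-\frac{k+1}{2}}\cdot\frac{n-m}{n}\cdot\frac{m+1}{n}$.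
   Context: $S(i,j)$ is the entry of $S$ in row $i$ (counted from the top, starting at 1) and column $j$ (counted from the left, starting at 1). A standard Young tableau fills the diagram with $1,\dots,n$ increasing along rows and down columns. -}

module Defs where

open import Data.Nat as ℕ using (ℕ; zero; suc; _<_; _≤_; _≥_; _∸_)
open import Data.Integer as ℤ using (ℤ; +_)
open import Data.Rational as ℚ using (ℚ; _/_)
open import Data.List using (List; []; _∷_; length; concat; map; upTo)
open import Data.Nat.ListAction using (sum)
open import Data.List.Relation.Unary.All using (All)
open import Data.List.Relation.Unary.Linked using (Linked)
open import Data.List.Relation.Binary.Permutation.Propositional using (_↭_)
open import Data.Maybe using (Maybe; just; nothing)
open import Data.Product using (_×_)
open import Relation.Binary.PropositionalEquality using (_≡_)
open import Relation.Nullary using (yes; no)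
open import Relation.Nullary.Decidable using (_×-dec_)

-- total division ℤ by ℕ into ℚ; only used with positive denominators
frac : ℤ → ℕ → ℚ
frac a zero    = ℚ.0ℚ
frac a (suc d) = a / suc d

nat : ℕ → ℚ
nat n = + n / 1

IsPartition : ℕ → List ℕ → Set
IsPartition n λs = All (λ p → 1 ≤ p) λs × Linked _≥_ λs × sum λs ≡ n

-- a tableau is given by its list of rows (top row first, entries left to right)
Tableau : Set
Tableau = List (List ℕ)

lookupL : List ℕ → ℕ → Maybe ℕ
lookupL []       _       = nothing
lookupL (x ∷ xs) zero    = just x
lookupL (x ∷ xs) (suc j) = lookupL xs j

-- entry in row i, column j (0-indexed here), if the cell exists
entry : Tableau → ℕ → ℕ → Maybe ℕ
entry []       _       j = nothing
entry (r ∷ rs) zero    j = lookupL r j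
entry (r ∷ rs) (suc i) j = entry rs i j

IsSYT : ℕ → List ℕ → Tableau → Set
IsSYT n λs S =
  map length S ≡ λs
  × concat S ↭ map suc (upTo n)
  × (∀ i j x y → entry S i j ≡ just x → entry S i (suc j) ≡ just y → x < y)
  × (∀ i j x y → entry S i j ≡ just x → entry S (suc i) j ≡ just y → x < y)

-- Σ over cells (i,j) (1-indexed) with n-k < S(i,j) ≤ n of (j - i)
rowContrib : ℕ → ℕ → ℕ → ℕ → List ℕ → ℤ
rowContrib n k i j []       = + 0
rowContrib n k i j (x ∷ xs) with (n ∸ k ℕ.<? x) ×-dec (x ℕ.≤? n)
... | yes _ = (+ j ℤ.- + i) ℤ.+ rowContrib n k i (suc j) xs
... | no  _ = rowContrib n k i (suc j) xs

contentSum : ℕ → ℕ → ℕ → Tableau → ℤ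
contentSum n k i []       = + 0
contentSum n k i (r ∷ rs) = rowContrib n k i 1 r ℤ.+ contentSum n k (suc i) rs

eig : ℕ → ℕ → Tableau → ℚ
eig n k S = frac (+ 1) n
  ℚ.+ frac (+ (2 ℕ.* (n ∸ 1))) (n ℕ.* k ℕ.* (2 ℕ.* n ∸ (k ℕ.+ 1))) ℚ.* (contentSum n k 1 S / 1)

-- the bound 1 - (n-1)/(n-(k+1)/2) * (n-a)/n * (a+1)/n, with
-- (n-1)/(n-(k+1)/2) written as 2(n-1)/(2n-(k+1))
bound : ℕ → ℕ → ℕ → ℚ
bound n k a = ℚ.1ℚ ℚ.- frac (+ (2 ℕ.* (n ∸ 1))) (2 ℕ.* n ∸ (k ℕ.+ 1))
                       ℚ.* frac (+ n ℤ.- + a) n ℚ.* frac (+ (a ℕ.+ 1)) n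

{-# OPTIONS --safe #-}
-- With C the content sum of the cells holding n − k + 1, …, n and T = (n − 1) + ⋯ + (n − k),
-- eig(S) = (T + (n − 1)C)/(nT).  Symmetrically, with
-- leftmost cells and m rows, −(n − 1)C ≤ (m − 1)T.
-- (ii) Splitting off the first row and merging the other rows into one run, a polynomial inequality
-- gives nC + k(n − λ₁)(λ₁ + 1) ≤ nT, i.e. eig(S) ≤ bound; the same holds for −C once
-- λ₁² ≥ λ₁ + 2(n − λ₁), which is where λ₁ > 6n/10 enters.  Splitting off the first column instead
-- gives the bound in m, with the roles of C and −C exchanged.
module Submission where

-- A submodule, so that the integer order used throughout does not clash with the ℕ-order
-- of the statement.
module Bounds where

  open import Defs
  open import Data.Nat.Base as ℕ using (ℕ; zero; suc; z≤n; s≤s)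
  import Data.Nat.Properties as ℕₚ
  import Data.Nat.Tactic.RingSolver as ℕ-Solver
  open import Data.Integer.Base as ℤ using (ℤ; +_; -[1+_]; +[1+_]; 0ℤ; 1ℤ; _+_; _-_; _*_; -_; _≤_; _<_; +≤+; -≤+; +<+)
  import Data.Integer.Properties as ℤₚ
  open import Data.Integer.Tactic.RingSolver using (solve-∀)
  open import Data.Rational.Base as ℚ using (ℚ; toℚᵘ)
  import Data.Rational.Properties as ℚₚ
  open import Data.Rational.Unnormalised.Base as ℚᵘ using (ℚᵘ; mkℚᵘ; ↥_; ↧_; *≡*; *≤*)
  open import Data.List.Base using (List; []; _∷_; [_]; _++_; _∷ʳ_; length; map; concat; filter; take; drop; upTo; applyUpTo)
  import Data.List.Properties as Listₚ
  open import Data.Nat.ListAction using (sum)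
  open import Data.List.Relation.Binary.Pointwise using (Pointwise; []; _∷_)
  open import Data.List.Relation.Binary.Permutation.Propositional using (_↭_)
  open import Data.List.Relation.Binary.Permutation.Propositional.Properties using (↭-length; filter-↭)
  open import Data.List.Relation.Unary.All as All using (All; []; _∷_)
  open import Data.List.Relation.Unary.Linked as Linked using (Linked; []; [-]; _∷_)
  open import Data.List.Relation.Unary.Linked.Properties using (Linked⇒All)
  open import Data.Product using (_×_; _,_; proj₁; ∃)
  open import Data.Sum using (inj₁; inj₂)
  open import Data.Empty using (⊥-elim)
  open import Function.Base using (_∘_)
  open import Relation.Nullary using (yes; no; Dec; ¬_)
  open import Relation.Nullary.Decidable using (_×-dec_)
  open import Relation.Binary.PropositionalEquality using (_≡_; refl; sym; trans; cong; cong₂; subst; subst₂; module ≡-Reasoning)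

  0≤+ : ∀ n → 0ℤ ≤ + n
  0≤+ n = +≤+ z≤n

  0≤-+ : ∀ {x y} → 0ℤ ≤ x → 0ℤ ≤ y → 0ℤ ≤ x + y
  0≤-+ = ℤₚ.+-mono-≤

  0≤-* : ∀ {x y} → 0ℤ ≤ x → 0ℤ ≤ y → 0ℤ ≤ x * y
  0≤-* {+ a} {+ b} _ _ = subst (0ℤ ≤_) (ℤₚ.pos-* a b) (0≤+ (a ℕ.* b))

  0<-* : ∀ {x y} → 0ℤ < x → 0ℤ < y → 0ℤ < x * y
  0<-* {+[1+ a ]} {+[1+ b ]} _        _        = +<+ (s≤s z≤n)
  0<-* {+ zero}              (+<+ ()) _
  0<-* {+[1+ _ ]} {+ zero}   _        (+<+ ())

  0<+suc : ∀ m → 0ℤ < + suc m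
  0<+suc m = +<+ (s≤s z≤n)

  ≤-by : ∀ {x y} d → 0ℤ ≤ d → y ≡ x + d → x ≤ y
  ≤-by {x} d 0≤d refl = ℤₚ.≤-trans (ℤₚ.≤-reflexive (sym (ℤₚ.+-identityʳ x))) (ℤₚ.+-monoʳ-≤ x 0≤d)

  ≤-slack : ∀ {x y} t → y ≡ x + + t → x ≤ y
  ≤-slack {x} t refl = ℤₚ.i≤i+j x (+ t)

  ≤-⇒+≤ : ∀ {x y z} → x ≤ y - z → x + z ≤ y
  ≤-⇒+≤ {x} {y} {z} h = subst (x + z ≤_) (eq y z) (ℤₚ.+-monoˡ-≤ z h)
    where
    eq : ∀ y z → y - z + z ≡ y
    eq = solve-∀

  ≤⇒∃ : ∀ {m n} → m ℕ.≤ n → ∃ λ t → n ≡ m ℕ.+ t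
  ≤⇒∃ m≤n = _ , sym (ℕₚ.m+[n∸m]≡n m≤n)

  ≤-slackℕ : ∀ {m n} t → n ≡ m ℕ.+ t → m ℕ.≤ n
  ≤-slackℕ {m} t refl = ℕₚ.m≤m+n m t

  sum-mono : ∀ {ws rs} → Pointwise ℕ._≥_ ws rs → sum rs ℕ.≤ sum ws
  sum-mono []            = z≤n
  sum-mono (r≤w ∷ rs≤ws) = ℕₚ.+-mono-≤ r≤w (sum-mono rs≤ws)

  descSum : ℤ → ℕ → ℤ
  descSum c zero    = 0ℤ
  descSum c (suc r) = (c - + r) + descSum c r

  descSum-double : ∀ c r → + 2 * descSum c r ≡ + r * (+ 2 * c - + r + 1ℤ)
  descSum-double c zero    = refl
  descSum-double c (suc r) = begin
    + 2 * ((c - + r) + descSum c r)          ≡⟨ ℤₚ.*-distribˡ-+ (+ 2) (c - + r) (descSum c r) ⟩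
    + 2 * (c - + r) + + 2 * descSum c r      ≡⟨ cong (_+_ (+ 2 * (c - + r))) (descSum-double c r) ⟩
    + 2 * (c - + r) + + r * (+ 2 * c - + r + 1ℤ) ≡⟨ step c (+ r) ⟩
    (1ℤ + + r) * (+ 2 * c - (1ℤ + + r) + 1ℤ) ∎
    where
    open ≡-Reasoning
    step : ∀ c R → + 2 * (c - R) + R * (+ 2 * c - R + 1ℤ) ≡ (1ℤ + R) * (+ 2 * c - (1ℤ + R) + 1ℤ)
    step = solve-∀

  descSum-peel : ∀ c r → descSum c (suc r) ≡ c + descSum (c - 1ℤ) r
  descSum-peel c zero    = cong (_+ 0ℤ) (ℤₚ.+-identityʳ c)
  descSum-peel c (suc r) = begin
    (c - + suc r) + descSum c (suc r)            ≡⟨ cong (_+_ (c - + suc r)) (descSum-peel c r) ⟩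
    (c - + suc r) + (c + descSum (c - 1ℤ) r)     ≡⟨ step c (+ r) (descSum (c - 1ℤ) r) ⟩
    c + ((c - 1ℤ - + r) + descSum (c - 1ℤ) r)    ∎
    where
    open ≡-Reasoning
    step : ∀ c R D → (c - (1ℤ + R)) + (c + D) ≡ c + ((c - 1ℤ - R) + D)
    step = solve-∀

  descSum-+ : ∀ c p q → descSum c (q ℕ.+ p) ≡ descSum c p + descSum (c - + p) q
  descSum-+ c p zero    = sym (ℤₚ.+-identityʳ _)
  descSum-+ c p (suc q) = begin
    (c - + (q ℕ.+ p)) + descSum c (q ℕ.+ p)                      ≡⟨ cong₂ (λ x y → (c - x) + y) (ℤₚ.pos-+ q p) (descSum-+ c p q) ⟩
    (c - (+ q + + p)) + (descSum c p + descSum (c - + p) q)      ≡⟨ step c (+ p) (+ q) (descSum c p) (descSum (c - + p) q) ⟩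
    descSum c p + ((c - + p - + q) + descSum (c - + p) q)        ∎
    where
    open ≡-Reasoning
    step : ∀ c P Q X Y → (c - (Q + P)) + (X + Y) ≡ X + ((c - P - Q) + Y)
    step = solve-∀

  descSum-mono : ∀ {c d} r → c ≤ d → descSum c r ≤ descSum d r
  descSum-mono zero    c≤d = ℤₚ.≤-refl
  descSum-mono (suc r) c≤d = ℤₚ.+-mono-≤ (ℤₚ.+-monoˡ-≤ (- + r) c≤d) (descSum-mono r c≤d)

  descSum-merge : ∀ {c₁ c₂ c} p q → c₁ ≤ c → c₂ ≤ c - + p →
                  descSum c₁ p + descSum c₂ q ≤ descSum c (q ℕ.+ p)
  descSum-merge {c = c} p q c₁≤c c₂≤c-p = ℤₚ.≤-trans
    (ℤₚ.+-mono-≤ (descSum-mono p c₁≤c) (descSum-mono q c₂≤c-p))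
    (ℤₚ.≤-reflexive (sym (descSum-+ c p q)))

  descSums : (ℕ → ℕ → ℤ) → ℕ → List ℕ → List ℕ → ℤ
  descSums f i (w ∷ ws) (r ∷ rs) = descSum (f i w) r + descSums f (suc i) ws rs
  descSums f i _        _        = 0ℤ

  -- A segment of row i occupying columns s + 1, …, s + w has contents s + 1 − i, …, s + w − i.
  maxContent : ℕ → ℕ → ℕ → ℤ
  maxContent s i w = + s + + w - + i

  maxNegContent : ℕ → ℕ → ℕ → ℤ
  maxNegContent s i w = + i - + suc s

  descSums-maxContent≤ : ∀ s i {ws rs} → Pointwise ℕ._≥_ ws rs →
    descSums (maxContent s) i ws rs ≤ descSum (+ s + + sum ws - + i) (sum rs)
  descSums-maxContent≤ s i [] = ℤₚ.≤-refl
  descSums-maxContent≤ s i {w ∷ ws} {r ∷ rs} (r≤w ∷ rs≤ws)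
    with t , B≡R+t ← ≤⇒∃ (sum-mono rs≤ws) = begin
      descSum (maxContent s i w) r + descSums (maxContent s) (suc i) ws rs
        ≤⟨ ℤₚ.+-monoʳ-≤ (descSum (maxContent s i w) r) (descSums-maxContent≤ s (suc i) rs≤ws) ⟩
      descSum (maxContent s i w) r + descSum (+ s + + sum ws - + suc i) (sum rs)
        ≡⟨ ℤₚ.+-comm (descSum (maxContent s i w) r) _ ⟩
      descSum (+ s + + sum ws - + suc i) (sum rs) + descSum (maxContent s i w) r
        ≤⟨ descSum-merge (sum rs) r (≤-slack (suc w) rest-gap) (≤-slack t row-gap) ⟩
      descSum (+ s + + (w ℕ.+ sum ws) - + i) (r ℕ.+ sum rs) ∎
    where
    open ℤₚ.≤-Reasoning
    rest-gap : + s + + (w ℕ.+ sum ws) - + i ≡ (+ s + + sum ws - + suc i) + + suc w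
    rest-gap = eq (+ s) (+ w) (+ sum ws) (+ i)
      where
      eq : ∀ s w B i → s + (w + B) - i ≡ (s + B - (1ℤ + i)) + (1ℤ + w)
      eq = solve-∀
    row-gap : + s + + (w ℕ.+ sum ws) - + i - + sum rs ≡ maxContent s i w + + t
    row-gap rewrite B≡R+t = eq (+ s) (+ w) (+ sum rs) (+ t) (+ i)
      where
      eq : ∀ s w R t i → s + (w + (R + t)) - i - R ≡ s + w - i + t
      eq = solve-∀

  Linked-0∷⇒sum≡0 : ∀ {ws} → Linked ℕ._≥_ (0 ∷ ws) → sum ws ≡ 0
  Linked-0∷⇒sum≡0 {[]}     _         = refl
  Linked-0∷⇒sum≡0 {_ ∷ _} (z≤n ∷ l) = Linked-0∷⇒sum≡0 l

  descSums-maxNegContent≤ : ∀ s i {ws rs} → Pointwise ℕ._≥_ ws rs → Linked ℕ._≥_ ws →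
    descSums (maxNegContent s) i ws rs ≤ descSum (+ i + + sum ws - + suc (suc s)) (sum rs)
  descSums-maxNegContent≤ s i [] _ = ℤₚ.≤-refl
  descSums-maxNegContent≤ s i {zero ∷ ws} {.zero ∷ rs} (z≤n ∷ rs≤ws) ws↘ =
    subst₂ _≤_ (sym (ℤₚ.+-identityˡ _)) (trans (cong (descSum _) R≡0) (sym (cong (descSum _) R≡0)))
      (descSums-maxNegContent≤ s (suc i) rs≤ws (Linked.tail ws↘))
    where
    R≡0 : sum rs ≡ 0
    R≡0 = ℕₚ.n≤0⇒n≡0 (subst (sum rs ℕ.≤_) (Linked-0∷⇒sum≡0 ws↘) (sum-mono rs≤ws))
  descSums-maxNegContent≤ s i {suc w ∷ ws} {r ∷ rs} (r≤w ∷ rs≤ws) ws↘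
    with t , B≡R+t ← ≤⇒∃ (sum-mono rs≤ws) = begin
      descSum (maxNegContent s i (suc w)) r + descSums (maxNegContent s) (suc i) ws rs
        ≤⟨ ℤₚ.+-monoʳ-≤ (descSum (maxNegContent s i (suc w)) r) (descSums-maxNegContent≤ s (suc i) rs≤ws (Linked.tail ws↘)) ⟩
      descSum (maxNegContent s i (suc w)) r + descSum (+ suc i + + sum ws - + suc (suc s)) (sum rs)
        ≡⟨ ℤₚ.+-comm (descSum (maxNegContent s i (suc w)) r) _ ⟩
      descSum (+ suc i + + sum ws - + suc (suc s)) (sum rs) + descSum (maxNegContent s i (suc w)) r
        ≤⟨ descSum-merge (sum rs) r (≤-slack w rest-gap) (≤-slack (w ℕ.+ t) row-gap) ⟩
      descSum (+ i + + suc (w ℕ.+ sum ws) - + suc (suc s)) (r ℕ.+ sum rs) ∎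
    where
    open ℤₚ.≤-Reasoning
    rest-gap : + i + + suc (w ℕ.+ sum ws) - + suc (suc s) ≡ (+ suc i + + sum ws - + suc (suc s)) + + w
    rest-gap = eq (+ i) (+ w) (+ sum ws) (+ suc (suc s))
      where
      eq : ∀ i w B S → i + (1ℤ + (w + B)) - S ≡ ((1ℤ + i) + B - S) + w
      eq = solve-∀
    row-gap : + i + + suc (w ℕ.+ sum ws) - + suc (suc s) - + sum rs ≡ maxNegContent s i (suc w) + + (w ℕ.+ t)
    row-gap rewrite B≡R+t = eq (+ i) (+ w) (+ sum rs) (+ t) (+ s)
      where
      eq : ∀ i w R t s → i + (1ℤ + (w + (R + t))) - (1ℤ + (1ℤ + s)) - R ≡ i - (1ℤ + s) + (w + t)
      eq = solve-∀

  descSums-unitWidth≤ : ∀ i {ws rs} → All (ℕ._≤ 1) ws → Pointwise ℕ._≥_ ws rs →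
    descSums (maxContent 0) i ws rs ≤ descSum (1ℤ - + i) (sum rs)
  descSums-unitWidth≤ i [] [] = ℤₚ.≤-refl
  descSums-unitWidth≤ i {w ∷ ws} {r ∷ rs} (w≤1 ∷ ws≤1) (r≤w ∷ rs≤ws) = begin
      descSum (maxContent 0 i w) r + descSums (maxContent 0) (suc i) ws rs
        ≤⟨ ℤₚ.+-monoʳ-≤ (descSum (maxContent 0 i w) r) (descSums-unitWidth≤ (suc i) ws≤1 rs≤ws) ⟩
      descSum (maxContent 0 i w) r + descSum (1ℤ - + suc i) (sum rs)
        ≤⟨ descSum-merge r (sum rs) (ℤₚ.+-monoˡ-≤ (- + i) (+≤+ w≤1)) (rest≤ r (ℕₚ.≤-trans r≤w w≤1)) ⟩
      descSum (1ℤ - + i) (sum rs ℕ.+ r)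
        ≡⟨ cong (descSum (1ℤ - + i)) (ℕₚ.+-comm (sum rs) r) ⟩
      descSum (1ℤ - + i) (r ℕ.+ sum rs) ∎
    where
    open ℤₚ.≤-Reasoning
    rest≤ : ∀ r → r ℕ.≤ 1 → 1ℤ - + suc i ≤ 1ℤ - + i - + r
    rest≤ zero    _       = ≤-slack 1 (eq (+ i))
      where
      eq : ∀ i → 1ℤ - i - 0ℤ ≡ 1ℤ - (1ℤ + i) + 1ℤ
      eq = solve-∀
    rest≤ (suc zero) _   = ≤-slack 0 (eq (+ i))
      where
      eq : ∀ i → 1ℤ - i - 1ℤ ≡ 1ℤ - (1ℤ + i) + 0ℤ
      eq = solve-∀
    rest≤ (suc (suc _)) (s≤s ())

  data LowerBound (f : ℕ → ℕ → ℤ) (L : ℤ) : ℕ → List ℕ → List ℕ → Set where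
    []   : ∀ {i} → LowerBound f L i [] []
    skip : ∀ {i w ws rs} → LowerBound f L (suc i) ws rs → LowerBound f L i (w ∷ ws) (0 ∷ rs)
    keep : ∀ {i w ws r rs} → L ≤ f i w - + r → LowerBound f L (suc i) ws rs →
           LowerBound f L i (w ∷ ws) (suc r ∷ rs)

  LowerBound-tail : ∀ {f L i w ws r rs} → LowerBound f L i (w ∷ ws) (r ∷ rs) → LowerBound f L (suc i) ws rs
  LowerBound-tail (skip b)   = b
  LowerBound-tail (keep _ b) = b

  LowerBound-mono : ∀ {f L L′ i ws rs} → L′ ≤ L → LowerBound f L i ws rs → LowerBound f L′ i ws rs
  LowerBound-mono L′≤L []         = []
  LowerBound-mono L′≤L (skip b)   = skip (LowerBound-mono L′≤L b)
  LowerBound-mono L′≤L (keep h b) = keep (ℤₚ.≤-trans L′≤L h) (LowerBound-mono L′≤L b)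

  LowerBound-empty : ∀ {f L i ws rs} → Pointwise ℕ._≥_ ws rs → sum rs ≡ 0 → LowerBound f L i ws rs
  LowerBound-empty []              _  = []
  LowerBound-empty (z≤n ∷ rs≤ws) R≡0 = skip (LowerBound-empty rs≤ws R≡0)
  LowerBound-empty (s≤s _ ∷ _)     ()

  descSums-empty : ∀ f i {ws rs} → Pointwise ℕ._≥_ ws rs → sum rs ≡ 0 → descSums f i ws rs ≡ 0ℤ
  descSums-empty f i []              _   = refl
  descSums-empty f i (z≤n ∷ rs≤ws) R≡0 = trans (ℤₚ.+-identityˡ _) (descSums-empty f (suc i) rs≤ws R≡0)
  descSums-empty f i (s≤s _ ∷ _)     ()

  record MinSplit (f : ℕ → ℕ → ℤ) (i : ℕ) (ws rs : List ℕ) (k : ℕ) : Set where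
    field
      rest    : List ℕ
      minimum : ℤ
      fits    : Pointwise ℕ._≥_ ws rest
      size    : sum rest ≡ k
      split   : descSums f i ws rs ≡ minimum + descSums f i ws rest
      minimal : LowerBound f minimum i ws rs

  extractMin : ∀ f i {ws rs} k → Pointwise ℕ._≥_ ws rs → sum rs ≡ suc k → MinSplit f i ws rs k
  extractMin f i k (z≤n ∷ rs≤ws) R≡1+k = record
    { rest = 0 ∷ rest ; minimum = minimum ; fits = z≤n ∷ fits ; size = size
    ; split = trans (ℤₚ.+-identityˡ _) (trans split (cong (_+_ minimum) (sym (ℤₚ.+-identityˡ _))))
    ; minimal = skip minimal }
    where open MinSplit (extractMin f (suc i) k rs≤ws R≡1+k)
  extractMin f i {w ∷ ws} {suc r ∷ rs} k (r<w ∷ rs≤ws) R≡1+k with sum rs in R′≡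
  ... | zero = record
    { rest = r ∷ rs ; minimum = f i w - + r ; fits = ℕₚ.<⇒≤ r<w ∷ rs≤ws
    ; size = trans (cong (r ℕ.+_) R′≡) (ℕₚ.suc-injective R≡1+k)
    ; split = ℤₚ.+-assoc (f i w - + r) _ _
    ; minimal = keep ℤₚ.≤-refl (LowerBound-empty rs≤ws R′≡) }
  ... | suc k′ with MinSplit.minimum (extractMin f (suc i) k′ rs≤ws R′≡) ℤₚ.≤? f i w - + r
  ...   | yes L′≤L = record
    { rest = suc r ∷ rest ; minimum = minimum ; fits = r<w ∷ fits
    ; size = trans (cong (λ R → suc (r ℕ.+ R)) size) (trans (sym (ℕₚ.+-suc r k′)) (ℕₚ.suc-injective R≡1+k))
    ; split = trans (cong (_+_ (descSum (f i w) (suc r))) split) (swap (descSum (f i w) (suc r)) minimum _)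
    ; minimal = keep L′≤L minimal }
    where
    open MinSplit (extractMin f (suc i) k′ rs≤ws R′≡)
    swap : ∀ a b c → a + (b + c) ≡ b + (a + c)
    swap = solve-∀
  ...   | no L′≰L = record
    { rest = r ∷ rs ; minimum = f i w - + r ; fits = ℕₚ.<⇒≤ r<w ∷ rs≤ws
    ; size = trans (cong (r ℕ.+_) R′≡) (ℕₚ.suc-injective R≡1+k)
    ; split = ℤₚ.+-assoc (f i w - + r) _ _
    ; minimal = keep ℤₚ.≤-refl (LowerBound-mono (ℤₚ.<⇒≤ (ℤₚ.≰⇒> L′≰L)) minimal) }
    where open MinSplit (extractMin f (suc i) k′ rs≤ws R′≡)

  -- Peeling off the smallest term k times compares the terms with c, c − 1, …, c − k + 1 one at a time.
  descSums-termwise : ∀ f i ws (α β c : ℤ) →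
    (∀ {rs L} k → Pointwise ℕ._≥_ ws rs → sum rs ≡ suc k → LowerBound f L i ws rs → β * L ≤ α * (c - + k)) →
    ∀ {rs} k → Pointwise ℕ._≥_ ws rs → sum rs ≡ k → β * descSums f i ws rs ≤ α * descSum c k
  descSums-termwise f i ws α β c termwise zero rs≤ws R≡0 rewrite descSums-empty f i rs≤ws R≡0
    | ℤₚ.*-zeroʳ β | ℤₚ.*-zeroʳ α = ℤₚ.≤-refl
  descSums-termwise f i ws α β c termwise (suc k) rs≤ws R≡1+k = begin
    β * descSums f i ws _                         ≡⟨ cong (_*_ β) split ⟩
    β * (minimum + descSums f i ws rest)          ≡⟨ ℤₚ.*-distribˡ-+ β minimum _ ⟩
    β * minimum + β * descSums f i ws rest        ≤⟨ ℤₚ.+-mono-≤ (termwise k rs≤ws R≡1+k minimal)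
                                                                  (descSums-termwise f i ws α β c termwise k fits size) ⟩
    α * (c - + k) + α * descSum c k               ≡⟨ ℤₚ.*-distribˡ-+ α (c - + k) (descSum c k) ⟨
    α * descSum c (suc k)                         ∎
    where
    open ℤₚ.≤-Reasoning
    open MinSplit (extractMin f i k rs≤ws R≡1+k)

  maxContent-floor : ∀ {l i w r} → + suc l ≤ maxContent 0 i w - + r → suc l ℕ.+ r ℕ.+ i ℕ.≤ w
  maxContent-floor {i = i} {r = r} h = ℤₚ.drop‿+≤+ (≤-⇒+≤ {z = + i} (≤-⇒+≤ {z = + r} h))

  maxNegContent-floor : ∀ {l i r} → + suc l ≤ + i - 1ℤ - + r → suc l ℕ.+ r ℕ.+ 1 ℕ.≤ i
  maxNegContent-floor {r = r} h = ℤₚ.drop‿+≤+ (≤-⇒+≤ {z = 1ℤ} (≤-⇒+≤ {z = + r} h))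

  nonPos-floor-bound : ∀ n' a' {k} L → L ≤ 0ℤ → k ℕ.≤ n' → + n' * L ≤ + a' * (+ n' - + k)
  nonPos-floor-bound n' a' {k} L L≤0 k≤n' = ℤₚ.≤-trans
    (subst (+ n' * L ≤_) (ℤₚ.*-zeroʳ (+ n')) (ℤₚ.*-monoˡ-≤-nonNeg (+ n') L≤0))
    (0≤-* (0≤+ a') (ℤₚ.i≤j⇒0≤j-i (+≤+ k≤n')))

  floor-bound-from-ℕ : ∀ n' a' k L → n' ℕ.* L ℕ.+ a' ℕ.* k ℕ.≤ a' ℕ.* n' → + n' * + L ≤ + a' * (+ n' - + k)
  floor-bound-from-ℕ n' a' k L h = subst₂ _≤_ (eq₁ (+ n') (+ L) (+ a' * + k)) (eq₂ (+ n') (+ a') (+ k))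
    (ℤₚ.+-monoˡ-≤ (- (+ a' * + k)) (subst₂ _≤_ (cong₂ _+_ (ℤₚ.pos-* n' L) (ℤₚ.pos-* a' k)) (ℤₚ.pos-* a' n') (+≤+ h)))
    where
    eq₁ : ∀ N L AK → N * L + AK - AK ≡ N * L
    eq₁ = solve-∀
    eq₂ : ∀ N A K → A * N - A * K ≡ A * (N - K)
    eq₂ = solve-∀

  pred-sum-mono : ∀ {ws rs n k} → sum ws ≡ suc n → Pointwise ℕ._≥_ ws rs → sum rs ≡ suc k → k ℕ.≤ n
  pred-sum-mono n≡ rs≤ws R≡ = ℕₚ.≤-pred (subst₂ ℕ._≤_ R≡ n≡ (sum-mono rs≤ws))

  Linked⇒All≤head : ∀ {a ws} → Linked ℕ._≥_ (a ∷ ws) → All (ℕ._≤ a) (a ∷ ws)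
  Linked⇒All≤head = Linked⇒All (λ x≥y y≥z → ℕₚ.≤-trans y≥z x≥y) ℕₚ.≤-refl

  maxContent-floor-empty : ∀ {l i ws rs} → All (ℕ._≤ suc l) ws → Pointwise ℕ._≥_ ws rs →
    LowerBound (maxContent 0) (+ suc l) (suc i) ws rs → sum rs ≡ 0
  maxContent-floor-empty []            []              []         = refl
  maxContent-floor-empty (_ ∷ ws≤)     (_ ∷ rs≤ws)     (skip b)   = maxContent-floor-empty ws≤ rs≤ws b
  maxContent-floor-empty {l} (w≤ ∷ _) (_ ∷ _) (keep {r = r} h _) = ⊥-elim (ℕₚ.<-irrefl refl
    (ℕₚ.≤-<-trans (ℕₚ.m≤m+n (suc l) r) (ℕₚ.<-≤-trans (ℕₚ.m<m+n _ ℕ.z<s) (ℕₚ.≤-trans (maxContent-floor h) w≤))))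

  row-capacity : ∀ l d r w → suc l ℕ.+ r ℕ.+ 2 ℕ.≤ w → w ℕ.≤ suc (suc l) ℕ.+ d →
                 (suc l ℕ.+ d) ℕ.* suc r ℕ.≤ d ℕ.* w
  row-capacity l d r w lo hi with ≤⇒∃ lo | ≤⇒∃ hi
  ... | t , refl | u , eq with ℕₚ.+-cancelˡ-≡ (suc (suc l)) d (suc r ℕ.+ t ℕ.+ u) (trans eq (shift l r t u))
    where
    shift : ∀ l r t u → suc l ℕ.+ r ℕ.+ 2 ℕ.+ t ℕ.+ u ≡ suc (suc l) ℕ.+ (suc r ℕ.+ t ℕ.+ u)
    shift = ℕ-Solver.solve-∀
  ...   | refl = ≤-slackℕ (suc r ℕ.* suc t ℕ.+ (t ℕ.+ u) ℕ.* (suc (suc l) ℕ.+ t)) (expand l r t u)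
    where
    expand : ∀ l r t u → (suc r ℕ.+ t ℕ.+ u) ℕ.* (suc l ℕ.+ r ℕ.+ 2 ℕ.+ t)
           ≡ (suc l ℕ.+ (suc r ℕ.+ t ℕ.+ u)) ℕ.* suc r ℕ.+ (suc r ℕ.* suc t ℕ.+ (t ℕ.+ u) ℕ.* (suc (suc l) ℕ.+ t))
    expand = ℕ-Solver.solve-∀

  rows-capacity : ∀ l d i {ws rs} → 2 ℕ.≤ i → All (ℕ._≤ suc (suc l) ℕ.+ d) ws → Pointwise ℕ._≥_ ws rs →
    LowerBound (maxContent 0) (+ suc l) i ws rs → (suc l ℕ.+ d) ℕ.* sum rs ℕ.≤ d ℕ.* sum ws
  rows-capacity l d i 2≤i [] [] [] = ℕₚ.≤-reflexive (trans (ℕₚ.*-zeroʳ (suc l ℕ.+ d)) (sym (ℕₚ.*-zeroʳ d)))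
  rows-capacity l d i {w ∷ ws} {r ∷ rs} 2≤i (w≤ ∷ ws≤) (_ ∷ rs≤ws) b =
    subst₂ ℕ._≤_ (sym (ℕₚ.*-distribˡ-+ (suc l ℕ.+ d) r (sum rs))) (sym (ℕₚ.*-distribˡ-+ d w (sum ws)))
      (ℕₚ.+-mono-≤ (row b) (rows-capacity l d (suc i) (ℕₚ.m≤n⇒m≤1+n 2≤i) ws≤ rs≤ws (LowerBound-tail b)))
    where
    row : ∀ {r} → LowerBound (maxContent 0) (+ suc l) i (w ∷ ws) (r ∷ rs) → (suc l ℕ.+ d) ℕ.* r ℕ.≤ d ℕ.* w
    row (skip _)   = ℕₚ.≤-trans (ℕₚ.≤-reflexive (ℕₚ.*-zeroʳ (suc l ℕ.+ d))) z≤n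
    row (keep {r = r} h _) = row-capacity l d r w (ℕₚ.≤-trans (ℕₚ.+-monoʳ-≤ (suc l ℕ.+ r) 2≤i) (maxContent-floor h)) w≤

  maxContent-floor-arith : ∀ l d b r₁ R k → r₁ ℕ.≤ suc d → (suc l ℕ.+ d) ℕ.* R ℕ.≤ d ℕ.* b → r₁ ℕ.+ R ≡ suc k →
    (suc l ℕ.+ d ℕ.+ b) ℕ.* suc l ℕ.+ (suc l ℕ.+ d) ℕ.* k ℕ.≤ (suc l ℕ.+ d) ℕ.* (suc l ℕ.+ d ℕ.+ b)
  maxContent-floor-arith l d b r₁ R k r₁≤ aR≤db r₁+R≡ = begin
    (a ℕ.+ b) ℕ.* suc l ℕ.+ a ℕ.* k         ≤⟨ ℕₚ.+-monoʳ-≤ ((a ℕ.+ b) ℕ.* suc l) ak≤ ⟩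
    (a ℕ.+ b) ℕ.* suc l ℕ.+ (a ℕ.* d ℕ.+ d ℕ.* b) ≡⟨ collect l d b ⟩
    a ℕ.* (a ℕ.+ b)                         ∎
    where
    open ℕₚ.≤-Reasoning
    a : ℕ
    a = suc l ℕ.+ d
    a+ak≤ : a ℕ.+ a ℕ.* k ℕ.≤ a ℕ.+ (a ℕ.* d ℕ.+ d ℕ.* b)
    a+ak≤ = begin
      a ℕ.+ a ℕ.* k                 ≡⟨ ℕₚ.*-suc a k ⟨
      a ℕ.* suc k                   ≡⟨ cong (a ℕ.*_) r₁+R≡ ⟨
      a ℕ.* (r₁ ℕ.+ R)              ≡⟨ ℕₚ.*-distribˡ-+ a r₁ R ⟩
      a ℕ.* r₁ ℕ.+ a ℕ.* R          ≤⟨ ℕₚ.+-mono-≤ (ℕₚ.*-monoʳ-≤ a r₁≤) aR≤db ⟩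
      a ℕ.* suc d ℕ.+ d ℕ.* b       ≡⟨ cong (ℕ._+ d ℕ.* b) (ℕₚ.*-suc a d) ⟩
      a ℕ.+ a ℕ.* d ℕ.+ d ℕ.* b     ≡⟨ ℕₚ.+-assoc a (a ℕ.* d) (d ℕ.* b) ⟩
      a ℕ.+ (a ℕ.* d ℕ.+ d ℕ.* b)   ∎
    ak≤ : a ℕ.* k ℕ.≤ a ℕ.* d ℕ.+ d ℕ.* b
    ak≤ = ℕₚ.+-cancelˡ-≤ a _ _ a+ak≤
    collect : ∀ l d b → (suc l ℕ.+ d ℕ.+ b) ℕ.* suc l ℕ.+ ((suc l ℕ.+ d) ℕ.* d ℕ.+ d ℕ.* b)
                      ≡ (suc l ℕ.+ d) ℕ.* (suc l ℕ.+ d ℕ.+ b)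
    collect = ℕ-Solver.solve-∀

  maxContent-floor-bound : ∀ {a' n' ws rs k} L → Linked ℕ._≥_ (suc a' ∷ ws) → suc a' ℕ.+ sum ws ≡ suc n' →
    Pointwise ℕ._≥_ (suc a' ∷ ws) rs → sum rs ≡ suc k → LowerBound (maxContent 0) L 1 (suc a' ∷ ws) rs →
    + n' * L ≤ + a' * (+ n' - + k)
  maxContent-floor-bound {a'} {n'} -[1+ _ ] _ n≡ rs≤ws R≡ _ = nonPos-floor-bound n' a' _ -≤+ (pred-sum-mono n≡ rs≤ws R≡)
  maxContent-floor-bound {a'} {n'} (+ zero) _ n≡ rs≤ws R≡ _ = nonPos-floor-bound n' a' _ ℤₚ.≤-refl (pred-sum-mono n≡ rs≤ws R≡)
  maxContent-floor-bound {a'} {n'} {k = k} (+ suc l) ws↘ n≡ rs≤ws@(_ ∷ rest≤ws) R≡ b with suc l ℕₚ.≤? a'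
  ... | no l≮a' = ⊥-elim (ℕₚ.0≢1+n (trans (sym (maxContent-floor-empty shorter rs≤ws b)) R≡))
    where
    shorter : All (ℕ._≤ suc l) (suc a' ∷ _)
    shorter = All.map (λ w≤ → ℕₚ.≤-trans w≤ (s≤s (ℕₚ.≮⇒≥ l≮a'))) (Linked⇒All≤head ws↘)
  ... | yes l<a' with d , refl ← ≤⇒∃ l<a' =
    floor-bound-from-ℕ n' (suc l ℕ.+ d) k (suc l)
      (subst (λ n' → n' ℕ.* suc l ℕ.+ (suc l ℕ.+ d) ℕ.* k ℕ.≤ (suc l ℕ.+ d) ℕ.* n') (ℕₚ.suc-injective n≡)
      (maxContent-floor-arith l d _ _ _ _ (first-row b)
        (rows-capacity l d 2 ℕₚ.≤-refl (All.tail (Linked⇒All≤head ws↘)) rest≤ws (LowerBound-tail b)) R≡))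
    where
    first-row : ∀ {r₁ ws rs} → LowerBound (maxContent 0) (+ suc l) 1 (suc (suc l ℕ.+ d) ∷ ws) (r₁ ∷ rs) → r₁ ℕ.≤ suc d
    first-row (skip _)   = z≤n
    first-row (keep {r = r} h _) = s≤s (ℕₚ.+-cancelˡ-≤ (suc l) r d
      (ℕₚ.≤-pred (subst (ℕ._≤ suc (suc l ℕ.+ d)) (ℕₚ.+-comm (suc l ℕ.+ r) 1) (maxContent-floor h))))

  sum≤length* : ∀ {x ws} → All (ℕ._≤ x) ws → sum ws ℕ.≤ length ws ℕ.* x
  sum≤length* []         = z≤n
  sum≤length* (w≤ ∷ ws≤) = ℕₚ.+-mono-≤ w≤ (sum≤length* ws≤)

  -- If all selected cells have negated content ≥ l + 1, rows 1, …, l + 1 carry none of them and row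
  -- l + 2 at most one; `width` is the length of row l + 2 and `later` the number of rows after it.
  record Pivot (j u : ℕ) (ws rs : List ℕ) : Set where
    field
      width later : ℕ
      width≤      : width ℕ.≤ u
      rows        : length ws ≡ j ℕ.+ suc later
      cells       : j ℕ.* width ℕ.+ sum rs ℕ.≤ sum ws
      selected    : sum rs ℕ.≤ 1 ℕ.+ later ℕ.* width

  pivot : ∀ l j i {u ws rs} → i ℕ.+ j ≡ suc (suc l) → Linked ℕ._≥_ (u ∷ ws) → Pointwise ℕ._≥_ ws rs →
          LowerBound (maxNegContent 0) (+ suc l) i ws rs → 1 ℕ.≤ sum rs → Pivot j u ws rs
  pivot l j i _ _ [] _ ()
  pivot l zero i {ws = w ∷ ws} i≡ (u≥w ∷ ws↘) rs≤ws@(_ ∷ rest≤ws) b _ = record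
    { width = w ; later = length ws ; width≤ = u≥w ; rows = refl ; cells = sum-mono rs≤ws
    ; selected = ℕₚ.+-mono-≤ (pivot-row b)
                   (ℕₚ.≤-trans (sum-mono rest≤ws) (sum≤length* (All.tail (Linked⇒All≤head ws↘)))) }
    where
    pivot-row : ∀ {r rs} → LowerBound (maxNegContent 0) (+ suc l) i (w ∷ ws) (r ∷ rs) → r ℕ.≤ 1
    pivot-row (skip _)                   = z≤n
    pivot-row (keep {r = zero} _ _)      = ℕₚ.≤-refl
    pivot-row (keep {r = suc r} h _) = ⊥-elim (ℕₚ.<⇒≱ (≤-slackℕ {suc (suc (suc l))} r (overflow l r))
      (ℕₚ.≤-trans (maxNegContent-floor h) (ℕₚ.≤-reflexive (trans (sym (ℕₚ.+-identityʳ i)) i≡))))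
      where
      overflow : ∀ l r → suc l ℕ.+ suc r ℕ.+ 1 ≡ suc (suc (suc l)) ℕ.+ r
      overflow = ℕ-Solver.solve-∀
  pivot l (suc j) i {u} {w ∷ ws} i≡ (u≥w ∷ ws↘) (_ ∷ rs≤ws) (skip b) 1≤R = record
    { width = width ; later = later ; width≤ = ℕₚ.≤-trans width≤ u≥w ; rows = cong suc rows
    ; cells = subst (ℕ._≤ w ℕ.+ sum ws) (sym (ℕₚ.+-assoc width (j ℕ.* width) _)) (ℕₚ.+-mono-≤ width≤ cells)
    ; selected = selected }
    where
    open Pivot (pivot l j (suc i) (trans (sym (ℕₚ.+-suc i j)) i≡) ws↘ rs≤ws b 1≤R)
  pivot l (suc j) i i≡ _ (_ ∷ _) (keep {r = r} h _) _ = ⊥-elim (ℕₚ.<⇒≱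
    (≤-slackℕ {suc (suc (suc l))} (r ℕ.+ j) (overflow l r i j))
    (ℕₚ.≤-trans (ℕₚ.+-monoˡ-≤ (suc j) (maxNegContent-floor h)) (ℕₚ.≤-reflexive i≡)))
    where
    overflow : ∀ l r i j → suc l ℕ.+ r ℕ.+ 1 ℕ.+ suc j ≡ suc (suc (suc l)) ℕ.+ (r ℕ.+ j)
    overflow = ℕ-Solver.solve-∀

  maxNegContent-floor-arith : ∀ j p x n' k → j ℕ.* x ℕ.+ suc k ℕ.≤ suc n' → suc k ℕ.≤ 1 ℕ.+ p ℕ.* x →
    n' ℕ.* j ℕ.+ (j ℕ.+ p) ℕ.* k ℕ.≤ (j ℕ.+ p) ℕ.* n'
  maxNegContent-floor-arith j p x n' k cells selected = begin
    n' ℕ.* j ℕ.+ (j ℕ.+ p) ℕ.* k               ≡⟨ cong (n' ℕ.* j ℕ.+_) (ℕₚ.*-distribʳ-+ k j p) ⟩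
    n' ℕ.* j ℕ.+ (j ℕ.* k ℕ.+ p ℕ.* k)         ≤⟨ ℕₚ.+-monoʳ-≤ (n' ℕ.* j) (ℕₚ.+-monoˡ-≤ (p ℕ.* k) (ℕₚ.*-monoʳ-≤ j k≤px)) ⟩
    n' ℕ.* j ℕ.+ (j ℕ.* (p ℕ.* x) ℕ.+ p ℕ.* k) ≡⟨ cong (n' ℕ.* j ℕ.+_) (regroup j p x k) ⟩
    n' ℕ.* j ℕ.+ p ℕ.* (j ℕ.* x ℕ.+ k)         ≤⟨ ℕₚ.+-monoʳ-≤ (n' ℕ.* j) (ℕₚ.*-monoʳ-≤ p jx+k≤n') ⟩
    n' ℕ.* j ℕ.+ p ℕ.* n'                      ≡⟨ collect n' j p ⟩
    (j ℕ.+ p) ℕ.* n'                           ∎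
    where
    open ℕₚ.≤-Reasoning
    k≤px : k ℕ.≤ p ℕ.* x
    k≤px = ℕₚ.≤-pred selected
    jx+k≤n' : j ℕ.* x ℕ.+ k ℕ.≤ n'
    jx+k≤n' = ℕₚ.≤-pred (subst (ℕ._≤ suc n') (ℕₚ.+-suc (j ℕ.* x) k) cells)
    regroup : ∀ j p x k → j ℕ.* (p ℕ.* x) ℕ.+ p ℕ.* k ≡ p ℕ.* (j ℕ.* x ℕ.+ k)
    regroup = ℕ-Solver.solve-∀
    collect : ∀ n' j p → n' ℕ.* j ℕ.+ p ℕ.* n' ≡ (j ℕ.+ p) ℕ.* n'
    collect = ℕ-Solver.solve-∀

  maxNegContent-floor-bound : ∀ {m' n' ws rs k} L → Linked ℕ._≥_ ws → length ws ≡ suc m' → sum ws ≡ suc n' →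
    Pointwise ℕ._≥_ ws rs → sum rs ≡ suc k → LowerBound (maxNegContent 0) L 1 ws rs → + n' * L ≤ + m' * (+ n' - + k)
  maxNegContent-floor-bound {m'} {n'} -[1+ _ ] _ _ n≡ rs≤ws R≡ _ = nonPos-floor-bound n' m' _ -≤+ (pred-sum-mono n≡ rs≤ws R≡)
  maxNegContent-floor-bound {m'} {n'} (+ zero) _ _ n≡ rs≤ws R≡ _ = nonPos-floor-bound n' m' _ ℤₚ.≤-refl (pred-sum-mono n≡ rs≤ws R≡)
  maxNegContent-floor-bound (+ suc l) _ _ _ [] () _
  maxNegContent-floor-bound {m'} {n'} {k = k} (+ suc l) ws↘ m≡ n≡ rs≤ws@(_ ∷ _) R≡ b =
    floor-bound-from-ℕ n' m' k (suc l) (subst (λ m' → n' ℕ.* suc l ℕ.+ m' ℕ.* k ℕ.≤ m' ℕ.* n') m'≡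
      (maxNegContent-floor-arith (suc l) later width n' k (subst₂ ℕ._≤_ (cong (suc l ℕ.* width ℕ.+_) R≡) n≡ cells)
        (subst (ℕ._≤ 1 ℕ.+ later ℕ.* width) R≡ selected)))
    where
    open Pivot (pivot l (suc l) 1 refl (ℕₚ.≤-refl ∷ ws↘) rs≤ws b (subst (1 ℕ.≤_) (sym R≡) (s≤s z≤n)))
    m'≡ : suc l ℕ.+ later ≡ m'
    m'≡ = ℕₚ.suc-injective (trans (sym (trans rows (ℕₚ.+-suc (suc l) later))) m≡)

  Selected : ℕ → ℕ → ℕ → Set
  Selected n k x = n ℕ.∸ k ℕ.< x × x ℕ.≤ n

  selected? : ∀ n k x → Dec (Selected n k x)
  selected? n k x = (n ℕ.∸ k ℕₚ.<? x) ×-dec (x ℕₚ.≤? n)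

  selectedCount : ℕ → ℕ → List ℕ → ℕ
  selectedCount n k = length ∘ filter (selected? n k)

  selectedCount-accept : ∀ n k {x} xs → Selected n k x → selectedCount n k (x ∷ xs) ≡ suc (selectedCount n k xs)
  selectedCount-accept n k xs s = cong length (Listₚ.filter-accept (selected? n k) s)

  selectedCount-reject : ∀ n k {x} xs → ¬ Selected n k x → selectedCount n k (x ∷ xs) ≡ selectedCount n k xs
  selectedCount-reject n k xs ¬s = cong length (Listₚ.filter-reject (selected? n k) ¬s)

  selectedCount-++ : ∀ n k xs ys → selectedCount n k (xs ++ ys) ≡ selectedCount n k xs ℕ.+ selectedCount n k ys
  selectedCount-++ n k xs ys = trans (cong length (Listₚ.filter-++ (selected? n k) xs ys)) (Listₚ.length-++ (filter (selected? n k) xs))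

  selectedCount-concat : ∀ n k S → selectedCount n k (concat S) ≡ sum (map (selectedCount n k) S)
  selectedCount-concat n k []      = refl
  selectedCount-concat n k (r ∷ S) = trans (selectedCount-++ n k r (concat S)) (cong (selectedCount n k r ℕ.+_) (selectedCount-concat n k S))

  selectedCount≤length : ∀ n k xs → selectedCount n k xs ℕ.≤ length xs
  selectedCount≤length n k = Listₚ.length-filter (selected? n k)

  selectedCount-applyUpTo : ∀ n k L → L ℕ.≤ n → selectedCount n k (applyUpTo suc L) ≡ L ℕ.∸ (n ℕ.∸ k)
  selectedCount-applyUpTo n k zero    _   = sym (ℕₚ.0∸n≡0 (n ℕ.∸ k))
  selectedCount-applyUpTo n k (suc L) L<n = begin
    selectedCount n k (applyUpTo suc (suc L))                      ≡⟨ cong (selectedCount n k) (Listₚ.applyUpTo-∷ʳ suc L) ⟨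
    selectedCount n k (applyUpTo suc L ∷ʳ suc L)                   ≡⟨ selectedCount-++ n k (applyUpTo suc L) [ suc L ] ⟩
    selectedCount n k (applyUpTo suc L) ℕ.+ selectedCount n k [ suc L ]
      ≡⟨ cong (ℕ._+ selectedCount n k [ suc L ]) (selectedCount-applyUpTo n k L (ℕₚ.<⇒≤ L<n)) ⟩
    L ℕ.∸ (n ℕ.∸ k) ℕ.+ selectedCount n k [ suc L ]                 ≡⟨ lastEntry ⟩
    suc L ℕ.∸ (n ℕ.∸ k)                                            ∎
    where
    open ≡-Reasoning
    lastEntry : L ℕ.∸ (n ℕ.∸ k) ℕ.+ selectedCount n k [ suc L ] ≡ suc L ℕ.∸ (n ℕ.∸ k)
    lastEntry with n ℕ.∸ k ℕₚ.<? suc L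
    ... | yes n-k<1+L = begin
      L ℕ.∸ (n ℕ.∸ k) ℕ.+ selectedCount n k [ suc L ]
        ≡⟨ cong (L ℕ.∸ (n ℕ.∸ k) ℕ.+_) (selectedCount-accept n k [] (n-k<1+L , L<n)) ⟩
      L ℕ.∸ (n ℕ.∸ k) ℕ.+ 1                          ≡⟨ ℕₚ.+-comm _ 1 ⟩
      suc (L ℕ.∸ (n ℕ.∸ k))                          ≡⟨ ℕₚ.+-∸-assoc 1 (ℕₚ.≤-pred n-k<1+L) ⟨
      suc L ℕ.∸ (n ℕ.∸ k)                            ∎
    ... | no  n-k≮1+L = begin
      L ℕ.∸ (n ℕ.∸ k) ℕ.+ selectedCount n k [ suc L ]
        ≡⟨ cong (L ℕ.∸ (n ℕ.∸ k) ℕ.+_) (selectedCount-reject n k [] (n-k≮1+L ∘ proj₁)) ⟩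
      L ℕ.∸ (n ℕ.∸ k) ℕ.+ 0                          ≡⟨ ℕₚ.+-identityʳ _ ⟩
      L ℕ.∸ (n ℕ.∸ k)                                ≡⟨ ℕₚ.m≤n⇒m∸n≡0 (ℕₚ.≤-trans (ℕₚ.n≤1+n L) (ℕₚ.≮⇒≥ n-k≮1+L)) ⟩
      0                                              ≡⟨ ℕₚ.m≤n⇒m∸n≡0 (ℕₚ.≮⇒≥ n-k≮1+L) ⟨
      suc L ℕ.∸ (n ℕ.∸ k)                            ∎

  selectedCount-1…n : ∀ n k → k ℕ.≤ n → selectedCount n k (map suc (upTo n)) ≡ k
  selectedCount-1…n n k k≤n = begin
    selectedCount n k (map suc (upTo n))  ≡⟨ cong (selectedCount n k) (Listₚ.map-applyUpTo (λ x → x) suc n) ⟩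
    selectedCount n k (applyUpTo suc n)   ≡⟨ selectedCount-applyUpTo n k n ℕₚ.≤-refl ⟩
    n ℕ.∸ (n ℕ.∸ k)                       ≡⟨ ℕₚ.m∸[m∸n]≡n k≤n ⟩
    k                                     ∎
    where open ≡-Reasoning

  selectedCount-total : ∀ {n k} S → k ℕ.≤ n → concat S ↭ map suc (upTo n) → sum (map (selectedCount n k) S) ≡ k
  selectedCount-total {n} {k} S k≤n S↭1…n = begin
    sum (map (selectedCount n k) S)       ≡⟨ selectedCount-concat n k S ⟨
    selectedCount n k (concat S)          ≡⟨ ↭-length (filter-↭ (selected? n k) S↭1…n) ⟩
    selectedCount n k (map suc (upTo n))  ≡⟨ selectedCount-1…n n k k≤n ⟩
    k                                     ∎
    where open ≡-Reasoning

  selectedCount-fits : ∀ n k S → Pointwise ℕ._≥_ (map length S) (map (selectedCount n k) S)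
  selectedCount-fits n k []      = []
  selectedCount-fits n k (r ∷ S) = selectedCount≤length n k r ∷ selectedCount-fits n k S

  maxContent-shift : ∀ s i w → maxContent (suc s) i w ≡ maxContent s i (suc w)
  maxContent-shift s i w = cong (λ z → + z - + i) (sym (ℕₚ.+-suc s w))

  rowContrib≤ : ∀ n k i s xs → rowContrib n k i (suc s) xs ≤ descSum (maxContent s i (length xs)) (selectedCount n k xs)
  rowContrib≤ n k i s []       = ℤₚ.≤-refl
  rowContrib≤ n k i s (x ∷ xs) with selected? n k x
  ... | yes sel with t , len≡ ← ≤⇒∃ (selectedCount≤length n k xs) = begin
    (+ suc s - + i) + rowContrib n k i (suc (suc s)) xs
      ≤⟨ ℤₚ.+-mono-≤ (≤-slack {x = + suc s - + i} t newest-gap) (rowContrib≤ n k i (suc s) xs) ⟩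
    (maxContent s i (suc (length xs)) - + c) + descSum (maxContent (suc s) i (length xs)) c
      ≡⟨ cong (λ d → (maxContent s i (suc (length xs)) - + c) + descSum d c) (maxContent-shift s i (length xs)) ⟩
    descSum (maxContent s i (suc (length xs))) (suc c)
      ≡⟨ cong (descSum _) (selectedCount-accept n k xs sel) ⟨
    descSum (maxContent s i (suc (length xs))) (selectedCount n k (x ∷ xs)) ∎
    where
    open ℤₚ.≤-Reasoning
    c : ℕ
    c = selectedCount n k xs
    newest-gap : maxContent s i (suc (length xs)) - + c ≡ (+ suc s - + i) + + t
    newest-gap rewrite len≡ = eq (+ s) (+ c) (+ t) (+ i)
      where
      eq : ∀ s c t i → s + (1ℤ + (c + t)) - i - c ≡ (1ℤ + s) - i + t
      eq = solve-∀
  ... | no ¬sel = subst₂ _≤_ refl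
    (cong₂ descSum (maxContent-shift s i (length xs)) (sym (selectedCount-reject n k xs ¬sel)))
    (rowContrib≤ n k i (suc s) xs)

  -rowContrib≤ : ∀ n k i s xs → - rowContrib n k i (suc s) xs ≤ descSum (maxNegContent s i (length xs)) (selectedCount n k xs)
  -rowContrib≤ n k i s []       = ℤₚ.≤-refl
  -rowContrib≤ n k i s (x ∷ xs) with selected? n k x
  ... | yes sel = begin
    - ((+ suc s - + i) + rowContrib n k i (suc (suc s)) xs)
      ≡⟨ distrib (+ suc s) (+ i) (rowContrib n k i (suc (suc s)) xs) ⟩
    (+ i - + suc s) + - rowContrib n k i (suc (suc s)) xs
      ≤⟨ ℤₚ.+-monoʳ-≤ (+ i - + suc s) (-rowContrib≤ n k i (suc s) xs) ⟩
    (+ i - + suc s) + descSum (+ i - + suc (suc s)) c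
      ≡⟨ cong (λ d → (+ i - + suc s) + descSum d c) (step (+ i) (+ s)) ⟩
    (+ i - + suc s) + descSum (+ i - + suc s - 1ℤ) c
      ≡⟨ descSum-peel (+ i - + suc s) c ⟨
    descSum (+ i - + suc s) (suc c)
      ≡⟨ cong (descSum _) (selectedCount-accept n k xs sel) ⟨
    descSum (+ i - + suc s) (selectedCount n k (x ∷ xs)) ∎
    where
    open ℤₚ.≤-Reasoning
    c : ℕ
    c = selectedCount n k xs
    distrib : ∀ S I R → - ((S - I) + R) ≡ (I - S) + - R
    distrib = solve-∀
    step : ∀ I S → I - (1ℤ + (1ℤ + S)) ≡ I - (1ℤ + S) - 1ℤ
    step = solve-∀
  ... | no ¬sel = subst₂ _≤_ refl (cong (descSum _) (sym (selectedCount-reject n k xs ¬sel)))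
    (ℤₚ.≤-trans (-rowContrib≤ n k i (suc s) xs)
      (descSum-mono (selectedCount n k xs) (≤-slack {x = + i - + suc (suc s)} 1 (step (+ i) (+ s)))))
    where
    step : ∀ I S → I - (1ℤ + S) ≡ I - (1ℤ + (1ℤ + S)) + 1ℤ
    step = solve-∀

  -- The content sum of the selected entries when the t-th list of S fills row i + t from column s + 1 on.
  segmentSum : ℕ → ℕ → ℕ → ℕ → Tableau → ℤ
  segmentSum n k i s []       = 0ℤ
  segmentSum n k i s (r ∷ rs) = rowContrib n k i (suc s) r + segmentSum n k (suc i) s rs

  contentSum≡segmentSum : ∀ n k i S → contentSum n k i S ≡ segmentSum n k i 0 S
  contentSum≡segmentSum n k i []      = refl
  contentSum≡segmentSum n k i (r ∷ S) = cong (_+_ (rowContrib n k i 1 r)) (contentSum≡segmentSum n k (suc i) S)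

  segmentSum≤ : ∀ n k i s S → segmentSum n k i s S ≤ descSums (maxContent s) i (map length S) (map (selectedCount n k) S)
  segmentSum≤ n k i s []      = ℤₚ.≤-refl
  segmentSum≤ n k i s (r ∷ S) = ℤₚ.+-mono-≤ (rowContrib≤ n k i s r) (segmentSum≤ n k (suc i) s S)

  -segmentSum≤ : ∀ n k i s S → - segmentSum n k i s S ≤ descSums (maxNegContent s) i (map length S) (map (selectedCount n k) S)
  -segmentSum≤ n k i s []      = ℤₚ.≤-refl
  -segmentSum≤ n k i s (r ∷ S) = ℤₚ.≤-trans (ℤₚ.≤-reflexive (ℤₚ.neg-distrib-+ (rowContrib n k i (suc s) r) _))
    (ℤₚ.+-mono-≤ (-rowContrib≤ n k i s r) (-segmentSum≤ n k (suc i) s S))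

  contentSum≤ : ∀ n k i S → contentSum n k i S ≤ descSums (maxContent 0) i (map length S) (map (selectedCount n k) S)
  contentSum≤ n k i S = subst (_≤ descSums (maxContent 0) i (map length S) (map (selectedCount n k) S))
    (sym (contentSum≡segmentSum n k i S)) (segmentSum≤ n k i 0 S)

  -contentSum≤ : ∀ n k i S → - contentSum n k i S ≤ descSums (maxNegContent 0) i (map length S) (map (selectedCount n k) S)
  -contentSum≤ n k i S = subst (λ C → - C ≤ descSums (maxNegContent 0) i (map length S) (map (selectedCount n k) S))
    (sym (contentSum≡segmentSum n k i S)) (-segmentSum≤ n k i 0 S)

  rowContrib-take+drop : ∀ n k i xs → rowContrib n k i 1 xs ≡ rowContrib n k i 1 (take 1 xs) + rowContrib n k i 2 (drop 1 xs)
  rowContrib-take+drop n k i []       = refl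
  rowContrib-take+drop n k i (x ∷ xs) with selected? n k x
  ... | yes _ = sym (cong (_+ rowContrib n k i 2 xs) (ℤₚ.+-identityʳ (+ 1 - + i)))
  ... | no  _ = sym (ℤₚ.+-identityˡ _)

  contentSum-columns : ∀ n k i S → contentSum n k i S ≡ segmentSum n k i 0 (map (take 1) S) + segmentSum n k i 1 (map (drop 1) S)
  contentSum-columns n k i []      = refl
  contentSum-columns n k i (r ∷ S) = begin
    rowContrib n k i 1 r + contentSum n k (suc i) S
      ≡⟨ cong₂ _+_ (rowContrib-take+drop n k i r) (contentSum-columns n k (suc i) S) ⟩
    (rowContrib n k i 1 (take 1 r) + rowContrib n k i 2 (drop 1 r))
      + (segmentSum n k (suc i) 0 (map (take 1) S) + segmentSum n k (suc i) 1 (map (drop 1) S))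
      ≡⟨ interchange (rowContrib n k i 1 (take 1 r)) (rowContrib n k i 2 (drop 1 r))
                     (segmentSum n k (suc i) 0 (map (take 1) S)) (segmentSum n k (suc i) 1 (map (drop 1) S)) ⟩
    segmentSum n k i 0 (map (take 1) (r ∷ S)) + segmentSum n k i 1 (map (drop 1) (r ∷ S)) ∎
    where
    open ≡-Reasoning
    interchange : ∀ a b c d → (a + b) + (c + d) ≡ (a + c) + (b + d)
    interchange = solve-∀

  sum-map-take+drop : ∀ (f : List ℕ → ℕ) → (∀ xs ys → f (xs ++ ys) ≡ f xs ℕ.+ f ys) → ∀ (S : Tableau) →
    sum (map f S) ≡ sum (map f (map (take 1) S)) ℕ.+ sum (map f (map (drop 1) S))
  sum-map-take+drop f f-++ []      = refl
  sum-map-take+drop f f-++ (r ∷ S) = begin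
    f r ℕ.+ sum (map f S)
      ≡⟨ cong₂ ℕ._+_ (trans (cong f (sym (Listₚ.take++drop≡id 1 r))) (f-++ (take 1 r) (drop 1 r))) (sum-map-take+drop f f-++ S) ⟩
    (f (take 1 r) ℕ.+ f (drop 1 r)) ℕ.+ (sum (map f (map (take 1) S)) ℕ.+ sum (map f (map (drop 1) S)))
      ≡⟨ interchange (f (take 1 r)) (f (drop 1 r)) _ _ ⟩
    sum (map f (map (take 1) (r ∷ S))) ℕ.+ sum (map f (map (drop 1) (r ∷ S))) ∎
    where
    open ≡-Reasoning
    interchange : ∀ a b c d → (a ℕ.+ b) ℕ.+ (c ℕ.+ d) ≡ (a ℕ.+ c) ℕ.+ (b ℕ.+ d)
    interchange = ℕ-Solver.solve-∀

  firstColumn-length : ∀ {S : Tableau} → All (1 ℕ.≤_) (map length S) → sum (map length (map (take 1) S)) ≡ length S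
  firstColumn-length {[]}          []        = refl
  firstColumn-length {(_ ∷ _) ∷ S} (_ ∷ pos) = cong suc (firstColumn-length pos)

  firstColumn-≤1 : ∀ (S : Tableau) → All (ℕ._≤ 1) (map length (map (take 1) S))
  firstColumn-≤1 []             = []
  firstColumn-≤1 ([] ∷ S)       = z≤n ∷ firstColumn-≤1 S
  firstColumn-≤1 ((_ ∷ _) ∷ S)  = s≤s z≤n ∷ firstColumn-≤1 S

  firstColumn-linked : ∀ {S : Tableau} → All (1 ℕ.≤_) (map length S) → Linked ℕ._≥_ (map length (map (take 1) S))
  firstColumn-linked {[]}                      _               = []
  firstColumn-linked {[] ∷ _}                  (() ∷ _)
  firstColumn-linked {(_ ∷ _) ∷ []}            _               = [-]
  firstColumn-linked {(_ ∷ _) ∷ [] ∷ _}        (_ ∷ () ∷ _)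
  firstColumn-linked {(_ ∷ _) ∷ r@(_ ∷ _) ∷ S} (_ ∷ pos)       = ℕₚ.≤-refl ∷ firstColumn-linked {r ∷ S} pos

  otherColumns-linked : ∀ {S : Tableau} → Linked ℕ._≥_ (map length S) → Linked ℕ._≥_ (map length (map (drop 1) S))
  otherColumns-linked {[]}         _          = []
  otherColumns-linked {_ ∷ []}     _          = [-]
  otherColumns-linked {r ∷ r′ ∷ S} (r≥r′ ∷ l) =
    subst₂ ℕ._≥_ (sym (Listₚ.length-drop 1 r)) (sym (Listₚ.length-drop 1 r′)) (ℕₚ.∸-monoˡ-≤ 1 r≥r′)
    ∷ otherColumns-linked {r′ ∷ S} l

  twiceDescSum : ℤ → ℤ → ℤ
  twiceDescSum c R = R * (+ 2 * c - R + 1ℤ)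

  closedForms≤ : ∀ N E c₁ c₂ c p q {X} → 0ℤ ≤ N → X ≤ descSum c₁ p + descSum c₂ q →
    N * (twiceDescSum c₁ (+ p) + twiceDescSum c₂ (+ q)) + + 2 * E ≤ N * twiceDescSum c (+ p + + q) →
    N * X + E ≤ N * descSum c (p ℕ.+ q)
  closedForms≤ N E c₁ c₂ c p q 0≤N X≤ h = ℤₚ.≤-trans
    (ℤₚ.+-monoˡ-≤ E (ℤₚ.*-monoˡ-≤-nonNeg N {{ℤ.nonNegative 0≤N}} X≤))
    (ℤₚ.*-cancelˡ-≤-pos _ _ (+ 2) (subst₂ _≤_ (sym lhs) (sym rhs) h))
    where
    open ≡-Reasoning
    lhs : + 2 * (N * (descSum c₁ p + descSum c₂ q) + E) ≡ N * (twiceDescSum c₁ (+ p) + twiceDescSum c₂ (+ q)) + + 2 * E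
    lhs = begin
      + 2 * (N * (descSum c₁ p + descSum c₂ q) + E)             ≡⟨ distrib N (descSum c₁ p) (descSum c₂ q) E ⟩
      N * (+ 2 * descSum c₁ p + + 2 * descSum c₂ q) + + 2 * E
        ≡⟨ cong₂ (λ x y → N * (x + y) + + 2 * E) (descSum-double c₁ p) (descSum-double c₂ q) ⟩
      N * (twiceDescSum c₁ (+ p) + twiceDescSum c₂ (+ q)) + + 2 * E ∎
      where
      distrib : ∀ N x y E → + 2 * (N * (x + y) + E) ≡ N * (+ 2 * x + + 2 * y) + + 2 * E
      distrib = solve-∀
    rhs : + 2 * (N * descSum c (p ℕ.+ q)) ≡ N * twiceDescSum c (+ p + + q)
    rhs = trans (swap N (descSum c (p ℕ.+ q))) (cong (N *_) (descSum-double c (p ℕ.+ q)))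
      where
      swap : ∀ N x → + 2 * (N * x) ≡ N * (+ 2 * x)
      swap = solve-∀

  block-polynomial₀ : ∀ p x q →
    + (p ℕ.+ x ℕ.+ q) * (twiceDescSum (+ (p ℕ.+ x) - 1ℤ) (+ p) + twiceDescSum (+ q - + 2) (+ q))
      + + 2 * (+ (p ℕ.+ q) * + q * (+ (p ℕ.+ x) + 1ℤ))
    ≤ + (p ℕ.+ x ℕ.+ q) * twiceDescSum (+ (p ℕ.+ x ℕ.+ q) - 1ℤ) (+ p + + q)
  block-polynomial₀ p x q = ≤-by (+ 2 * (Q * (P * X + X * X + X)))
    (0≤-* (0≤+ 2) (0≤-* (0≤+ q) (0≤-+ (0≤-+ (0≤-* (0≤+ p) (0≤+ x)) (0≤-* (0≤+ x) (0≤+ x))) (0≤+ x))))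
    (expand P X Q)
    where
    P Q X : ℤ
    P = + p
    Q = + q
    X = + x
    expand : ∀ P X Q → (P + X + Q) * ((P + Q) * (+ 2 * ((P + X + Q) - 1ℤ) - (P + Q) + 1ℤ))
      ≡ ((P + X + Q) * ((P * (+ 2 * ((P + X) - 1ℤ) - P + 1ℤ)) + (Q * (+ 2 * (Q - + 2) - Q + 1ℤ)))
         + + 2 * ((P + Q) * Q * ((P + X) + 1ℤ))) + + 2 * (Q * (P * X + X * X + X))
    expand = solve-∀

  block-polynomial₊ : ∀ p x q y →
    + (p ℕ.+ x ℕ.+ (suc q ℕ.+ y)) * (twiceDescSum (+ (p ℕ.+ x) - 1ℤ) (+ p) + twiceDescSum (+ (suc q ℕ.+ y) - + 2) (+ q))
      + + 2 * (+ (p ℕ.+ q) * + (suc q ℕ.+ y) * (+ (p ℕ.+ x) + 1ℤ))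
    ≤ + (p ℕ.+ x ℕ.+ (suc q ℕ.+ y)) * twiceDescSum (+ (p ℕ.+ x ℕ.+ (suc q ℕ.+ y)) - 1ℤ) (+ p + + q)
  block-polynomial₊ p x q y = ≤-by (+ 2 * (P * (Q + 1ℤ + Y) * Y + Q * (P + X) * (X + 1ℤ)))
    (0≤-* (0≤+ 2) (0≤-+ (0≤-* (0≤-* (0≤+ p) (0≤+ (q ℕ.+ 1 ℕ.+ y))) (0≤+ y))
                        (0≤-* (0≤-* (0≤+ q) (0≤+ (p ℕ.+ x))) (0≤+ (x ℕ.+ 1)))))
    (expand P X Q Y)
    where
    P Q X Y : ℤ
    P = + p
    Q = + q
    X = + x
    Y = + y
    expand : ∀ P X Q Y → (P + X + ((1ℤ + Q) + Y)) * ((P + Q) * (+ 2 * ((P + X + ((1ℤ + Q) + Y)) - 1ℤ) - (P + Q) + 1ℤ))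
      ≡ ((P + X + ((1ℤ + Q) + Y)) * ((P * (+ 2 * ((P + X) - 1ℤ) - P + 1ℤ)) + (Q * (+ 2 * (((1ℤ + Q) + Y) - + 2) - Q + 1ℤ)))
         + + 2 * ((P + Q) * ((1ℤ + Q) + Y) * ((P + X) + 1ℤ))) + + 2 * (P * (Q + 1ℤ + Y) * Y + Q * (P + X) * (X + 1ℤ))
    expand = solve-∀

  block-estimate : ∀ a b p q {X} → p ℕ.≤ a → q ℕ.≤ b → X ≤ descSum (+ a - 1ℤ) p + descSum (+ b - + 2) q →
    + (a ℕ.+ b) * X + + (p ℕ.+ q) * + b * (+ a + 1ℤ) ≤ + (a ℕ.+ b) * descSum (+ (a ℕ.+ b) - 1ℤ) (p ℕ.+ q)
  block-estimate a b p q p≤a q≤b X≤ with x , refl ← ≤⇒∃ p≤a | ℕₚ.m≤n⇒m<n∨m≡n q≤b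
  ... | inj₂ refl =
    closedForms≤ (+ (p ℕ.+ x ℕ.+ q)) (+ (p ℕ.+ q) * + q * (+ (p ℕ.+ x) + 1ℤ))
      (+ (p ℕ.+ x) - 1ℤ) (+ q - + 2) (+ (p ℕ.+ x ℕ.+ q) - 1ℤ) p q (0≤+ _) X≤ (block-polynomial₀ p x q)
  ... | inj₁ q<b with y , refl ← ≤⇒∃ q<b =
    closedForms≤ (+ (p ℕ.+ x ℕ.+ (suc q ℕ.+ y))) (+ (p ℕ.+ q) * + (suc q ℕ.+ y) * (+ (p ℕ.+ x) + 1ℤ))
      (+ (p ℕ.+ x) - 1ℤ) (+ (suc q ℕ.+ y) - + 2) (+ (p ℕ.+ x ℕ.+ (suc q ℕ.+ y)) - 1ℤ) p q (0≤+ _) X≤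
      (block-polynomial₊ p x q y)

  block-polynomial′ : ∀ a p q y → 0ℤ ≤ + a * + a - + a - + 2 * (+ q + + y) →
    + (a ℕ.+ (q ℕ.+ y)) * (twiceDescSum 0ℤ (+ p) + twiceDescSum (+ (q ℕ.+ y)) (+ q)) + + 2 * (+ (p ℕ.+ q) * + (q ℕ.+ y) * (+ a + 1ℤ))
    ≤ + (a ℕ.+ (q ℕ.+ y)) * twiceDescSum (+ (a ℕ.+ (q ℕ.+ y)) - 1ℤ) (+ p + + q)
  block-polynomial′ a p q y 0≤Z = ≤-by (+ 2 * ((P + Q) * (A * A - A - + 2 * (Q + Y)) + P * (A + (Q + Y)) * Y))
    (0≤-* (0≤+ 2) (0≤-+ (0≤-* (0≤+ (p ℕ.+ q)) 0≤Z) (0≤-* (0≤-* (0≤+ p) (0≤+ (a ℕ.+ (q ℕ.+ y)))) (0≤+ y))))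
    (expand A P Q Y)
    where
    A P Q Y : ℤ
    A = + a
    P = + p
    Q = + q
    Y = + y
    expand : ∀ A P Q Y → (A + (Q + Y)) * ((P + Q) * (+ 2 * ((A + (Q + Y)) - 1ℤ) - (P + Q) + 1ℤ))
      ≡ ((A + (Q + Y)) * ((P * (+ 2 * 0ℤ - P + 1ℤ)) + (Q * (+ 2 * (Q + Y) - Q + 1ℤ)))
         + + 2 * ((P + Q) * (Q + Y) * (A + 1ℤ))) + + 2 * ((P + Q) * (A * A - A - + 2 * (Q + Y)) + P * (A + (Q + Y)) * Y)
    expand = solve-∀

  block-estimate′ : ∀ a b p q {X} → q ℕ.≤ b → 2 ℕ.* b ℕ.+ a ℕ.≤ a ℕ.* a → X ≤ descSum 0ℤ p + descSum (+ b) q →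
    + (a ℕ.+ b) * X + + (p ℕ.+ q) * + b * (+ a + 1ℤ) ≤ + (a ℕ.+ b) * descSum (+ (a ℕ.+ b) - 1ℤ) (p ℕ.+ q)
  block-estimate′ a b p q q≤b 2b+a≤a² X≤ with y , refl ← ≤⇒∃ q≤b =
    closedForms≤ (+ (a ℕ.+ (q ℕ.+ y))) (+ (p ℕ.+ q) * + (q ℕ.+ y) * (+ a + 1ℤ)) 0ℤ (+ (q ℕ.+ y)) (+ (a ℕ.+ (q ℕ.+ y)) - 1ℤ)
      p q (0≤+ _) X≤ (block-polynomial′ a p q y 0≤Z)
    where
    regroup : ∀ A B → A * A - (+ 2 * B + A) ≡ A * A - A - + 2 * B
    regroup = solve-∀
    0≤Z : 0ℤ ≤ + a * + a - + a - + 2 * (+ q + + y)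
    0≤Z = subst (0ℤ ≤_) (trans (cong₂ _-_ (ℤₚ.pos-* a a) (cong (_+ + a) (ℤₚ.pos-* 2 (q ℕ.+ y)))) (regroup (+ a) (+ q + + y)))
      (ℤₚ.i≤j⇒0≤j-i (+≤+ 2b+a≤a²))

  6[a+b]<10a⇒2b+a≤a² : ∀ a b → 6 ℕ.* (a ℕ.+ b) ℕ.< 10 ℕ.* a → 2 ℕ.* b ℕ.+ a ℕ.≤ a ℕ.* a
  6[a+b]<10a⇒2b+a≤a² a b h = 6b<4a⇒2b+a≤a² a b (ℕₚ.+-cancelˡ-≤ (6 ℕ.* a) _ _ (subst₂ ℕ._≤_ (split₁ a b) (split₂ a) h))
    where
    split₁ : ∀ a b → suc (6 ℕ.* (a ℕ.+ b)) ≡ 6 ℕ.* a ℕ.+ suc (6 ℕ.* b)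
    split₁ = ℕ-Solver.solve-∀
    split₂ : ∀ a → 10 ℕ.* a ≡ 6 ℕ.* a ℕ.+ 4 ℕ.* a
    split₂ = ℕ-Solver.solve-∀
    6b<4a⇒2b+a≤a² : ∀ a b → 6 ℕ.* b ℕ.< 4 ℕ.* a → 2 ℕ.* b ℕ.+ a ℕ.≤ a ℕ.* a
    6b<4a⇒2b+a≤a² zero b ()
    6b<4a⇒2b+a≤a² 1 b h with refl ← ℕₚ.n<1⇒n≡0 (ℕₚ.*-cancelˡ-< 6 b 1 (ℕₚ.≤-trans h (ℕₚ.m≤m+n 4 2))) = ℕₚ.≤-refl
    6b<4a⇒2b+a≤a² 2 b h with ℕₚ.*-cancelˡ-< 6 b 2 (ℕₚ.≤-trans h (ℕₚ.m≤m+n 8 4))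
    ... | s≤s z≤n       = s≤s (s≤s z≤n)
    ... | s≤s (s≤s z≤n) = s≤s (s≤s (s≤s (s≤s z≤n)))
    6b<4a⇒2b+a≤a² a@(suc (suc (suc t))) b h = ℕₚ.*-cancelˡ-≤ 3 (ℕₚ.<⇒≤ (begin-strict
      3 ℕ.* (2 ℕ.* b ℕ.+ a)     ≡⟨ expand b a ⟩
      6 ℕ.* b ℕ.+ 3 ℕ.* a       <⟨ ℕₚ.+-monoˡ-< (3 ℕ.* a) h ⟩
      4 ℕ.* a ℕ.+ 3 ℕ.* a       ≡⟨ collect a ⟩
      7 ℕ.* a                   ≤⟨ ℕₚ.*-monoˡ-≤ a (≤-slackℕ {7} (2 ℕ.+ 3 ℕ.* t) (three-a t)) ⟩
      3 ℕ.* a ℕ.* a             ≡⟨ ℕₚ.*-assoc 3 a a ⟩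
      3 ℕ.* (a ℕ.* a)           ∎))
      where
      open ℕₚ.≤-Reasoning
      expand : ∀ b a → 3 ℕ.* (2 ℕ.* b ℕ.+ a) ≡ 6 ℕ.* b ℕ.+ 3 ℕ.* a
      expand = ℕ-Solver.solve-∀
      collect : ∀ a → 4 ℕ.* a ℕ.+ 3 ℕ.* a ≡ 7 ℕ.* a
      collect = ℕ-Solver.solve-∀
      three-a : ∀ t → 3 ℕ.* (3 ℕ.+ t) ≡ 7 ℕ.+ (2 ℕ.+ 3 ℕ.* t)
      three-a = ℕ-Solver.solve-∀

  [n-1]C≤[λ₁-1]T : ∀ {n' k a' rest} S → map length S ≡ suc a' ∷ rest → Linked ℕ._≥_ (suc a' ∷ rest) →
    suc a' ℕ.+ sum rest ≡ suc n' → sum (map (selectedCount (suc n') k) S) ≡ k →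
    + n' * contentSum (suc n') k 1 S ≤ + a' * descSum (+ n') k
  [n-1]C≤[λ₁-1]T {n'} {k} {a'} S shape ws↘ n≡ k≡ = ℤₚ.≤-trans
    (ℤₚ.*-monoˡ-≤-nonNeg (+ n') (subst (λ ws → contentSum (suc n') k 1 S ≤ descSums (maxContent 0) 1 ws rs) shape
      (contentSum≤ (suc n') k 1 S)))
    (descSums-termwise (maxContent 0) 1 _ (+ a') (+ n') (+ n')
      (λ _ fits sel≡ lb → maxContent-floor-bound _ ws↘ n≡ fits sel≡ lb)
      k (subst (λ ws → Pointwise ℕ._≥_ ws rs) shape (selectedCount-fits (suc n') k S)) k≡)
    where
    rs : List ℕ
    rs = map (selectedCount (suc n') k) S

  -[n-1]C≤[m-1]T : ∀ {n' k m' ws} S → map length S ≡ ws → Linked ℕ._≥_ ws → length ws ≡ suc m' →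
    sum ws ≡ suc n' → sum (map (selectedCount (suc n') k) S) ≡ k →
    + n' * (- contentSum (suc n') k 1 S) ≤ + m' * descSum (+ n') k
  -[n-1]C≤[m-1]T {n'} {k} {m'} S refl ws↘ m≡ n≡ k≡ = ℤₚ.≤-trans
    (ℤₚ.*-monoˡ-≤-nonNeg (+ n') (-contentSum≤ (suc n') k 1 S))
    (descSums-termwise (maxNegContent 0) 1 _ (+ m') (+ n') (+ n')
      (λ _ fits sel≡ lb → maxNegContent-floor-bound _ ws↘ m≡ n≡ fits sel≡ lb)
      k (selectedCount-fits (suc n') k S) k≡)

  firstRow-bound : ∀ {n k λ₁ rest} row S₂ → map length (row ∷ S₂) ≡ λ₁ ∷ rest → λ₁ ℕ.+ sum rest ≡ n →
    sum (map (selectedCount n k) (row ∷ S₂)) ≡ k →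
    + n * contentSum n k 1 (row ∷ S₂) + + k * + sum rest * (+ λ₁ + 1ℤ) ≤ + n * descSum (+ n - 1ℤ) k
  firstRow-bound {n} {k} row S₂ refl refl k≡ =
    subst (λ K → + n * C + + K * + b * (+ a + 1ℤ) ≤ + n * descSum (+ n - 1ℤ) K) k≡
    (block-estimate a b (selectedCount n k row) (sum (map (selectedCount n k) S₂))
      (selectedCount≤length n k row) (sum-mono (selectedCount-fits n k S₂))
      (ℤₚ.+-mono-≤ (rowContrib≤ n k 1 0 row)
        (ℤₚ.≤-trans (contentSum≤ n k 2 S₂) (descSums-maxContent≤ 0 2 (selectedCount-fits n k S₂)))))
    where
    a b : ℕ
    a = length row
    b = sum (map length S₂)
    C : ℤ
    C = contentSum n k 1 (row ∷ S₂)

  firstRow-bound′ : ∀ {n k λ₁ rest} row S₂ → map length (row ∷ S₂) ≡ λ₁ ∷ rest → λ₁ ℕ.+ sum rest ≡ n →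
    sum (map (selectedCount n k) (row ∷ S₂)) ≡ k → Linked ℕ._≥_ (λ₁ ∷ rest) → 2 ℕ.* sum rest ℕ.+ λ₁ ℕ.≤ λ₁ ℕ.* λ₁ →
    + n * (- contentSum n k 1 (row ∷ S₂)) + + k * + sum rest * (+ λ₁ + 1ℤ) ≤ + n * descSum (+ n - 1ℤ) k
  firstRow-bound′ {n} {k} row S₂ refl refl k≡ ws↘ 2b+a≤a² =
    subst (λ K → + n * (- C) + + K * + b * (+ a + 1ℤ) ≤ + n * descSum (+ n - 1ℤ) K) k≡
    (block-estimate′ a b (selectedCount n k row) (sum (map (selectedCount n k) S₂))
      (sum-mono (selectedCount-fits n k S₂)) 2b+a≤a²
      (ℤₚ.≤-trans (ℤₚ.≤-reflexive (ℤₚ.neg-distrib-+ (rowContrib n k 1 1 row) (contentSum n k 2 S₂)))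
        (ℤₚ.+-mono-≤ (-rowContrib≤ n k 1 0 row)
          (ℤₚ.≤-trans (-contentSum≤ n k 2 S₂) (descSums-maxNegContent≤ 0 2 (selectedCount-fits n k S₂) (Linked.tail ws↘))))))
    where
    a b : ℕ
    a = length row
    b = sum (map length S₂)
    C : ℤ
    C = contentSum n k 1 (row ∷ S₂)

  module ColumnSplit {n k m : ℕ} (S : Tableau)
    (pos : All (1 ℕ.≤_) (map length S)) (ws↘ : Linked ℕ._≥_ (map length S)) (m≡ : length S ≡ m)
    (n≡ : sum (map length S) ≡ n) (k≡ : sum (map (selectedCount n k) S) ≡ k) where

    heads tails : Tableau
    heads = map (take 1) S
    tails = map (drop 1) S

    r q₁ q₂ : ℕ
    r  = sum (map length tails)
    q₁ = sum (map (selectedCount n k) heads)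
    q₂ = sum (map (selectedCount n k) tails)

    C : ℤ
    C = contentSum n k 1 S

    heads-width : sum (map length heads) ≡ m
    heads-width = trans (firstColumn-length pos) m≡

    m+r≡n : m ℕ.+ r ≡ n
    m+r≡n = trans (cong (ℕ._+ r) (sym heads-width))
      (trans (sym (sum-map-take+drop length (λ xs ys → Listₚ.length-++ xs) S)) n≡)

    q₁+q₂≡k : q₁ ℕ.+ q₂ ≡ k
    q₁+q₂≡k = trans (sym (sum-map-take+drop (selectedCount n k) (selectedCount-++ n k) S)) k≡

    q₁≤m : q₁ ℕ.≤ m
    q₁≤m = subst (q₁ ℕ.≤_) heads-width (sum-mono (selectedCount-fits n k heads))

    q₂≤r : q₂ ℕ.≤ r
    q₂≤r = sum-mono (selectedCount-fits n k tails)

    C-split : C ≡ segmentSum n k 1 0 heads + segmentSum n k 1 1 tails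
    C-split = contentSum-columns n k 1 S

    transport : ∀ {X} →
      + (m ℕ.+ r) * X + + (q₁ ℕ.+ q₂) * + r * (+ m + 1ℤ) ≤ + (m ℕ.+ r) * descSum (+ (m ℕ.+ r) - 1ℤ) (q₁ ℕ.+ q₂) →
      + n * X + + k * + r * (+ m + 1ℤ) ≤ + n * descSum (+ n - 1ℤ) k
    transport {X} = subst₂ (λ N K → + N * X + + K * + r * (+ m + 1ℤ) ≤ + N * descSum (+ N - 1ℤ) K) m+r≡n q₁+q₂≡k

    firstColumn-bound : + n * (- C) + + k * + r * (+ m + 1ℤ) ≤ + n * descSum (+ n - 1ℤ) k
    firstColumn-bound = transport (block-estimate m r q₁ q₂ q₁≤m q₂≤r (begin
      - C                                                          ≡⟨ cong -_ C-split ⟩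
      - (segmentSum n k 1 0 heads + segmentSum n k 1 1 tails)
        ≡⟨ ℤₚ.neg-distrib-+ (segmentSum n k 1 0 heads) (segmentSum n k 1 1 tails) ⟩
      - segmentSum n k 1 0 heads + - segmentSum n k 1 1 tails
        ≤⟨ ℤₚ.+-mono-≤ (-segmentSum≤ n k 1 0 heads) (-segmentSum≤ n k 1 1 tails) ⟩
      descSums (maxNegContent 0) 1 (map length heads) (map (selectedCount n k) heads)
        + descSums (maxNegContent 1) 1 (map length tails) (map (selectedCount n k) tails)
        ≤⟨ ℤₚ.+-mono-≤ (descSums-maxNegContent≤ 0 1 (selectedCount-fits n k heads) (firstColumn-linked pos))
                       (descSums-maxNegContent≤ 1 1 (selectedCount-fits n k tails) (otherColumns-linked ws↘)) ⟩
      descSum (+ 1 + + sum (map length heads) - + 2) q₁ + descSum (+ 1 + + r - + 3) q₂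
        ≡⟨ cong₂ (λ c c′ → descSum c q₁ + descSum c′ q₂)
             (trans (cong (λ h → + 1 + + h - + 2) heads-width) (shift₁ (+ m))) (shift₂ (+ r)) ⟩
      descSum (+ m - 1ℤ) q₁ + descSum (+ r - + 2) q₂ ∎))
      where
      open ℤₚ.≤-Reasoning
      shift₁ : ∀ M → 1ℤ + M - + 2 ≡ M - 1ℤ
      shift₁ = solve-∀
      shift₂ : ∀ R → 1ℤ + R - + 3 ≡ R - + 2
      shift₂ = solve-∀

    firstColumn-bound′ : 2 ℕ.* r ℕ.+ m ℕ.≤ m ℕ.* m → + n * C + + k * + r * (+ m + 1ℤ) ≤ + n * descSum (+ n - 1ℤ) k
    firstColumn-bound′ 2r+m≤m² = transport (block-estimate′ m r q₁ q₂ q₂≤r 2r+m≤m² (begin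
      C                                                            ≡⟨ C-split ⟩
      segmentSum n k 1 0 heads + segmentSum n k 1 1 tails
        ≤⟨ ℤₚ.+-mono-≤ (segmentSum≤ n k 1 0 heads) (segmentSum≤ n k 1 1 tails) ⟩
      descSums (maxContent 0) 1 (map length heads) (map (selectedCount n k) heads)
        + descSums (maxContent 1) 1 (map length tails) (map (selectedCount n k) tails)
        ≤⟨ ℤₚ.+-mono-≤ (descSums-unitWidth≤ 1 (firstColumn-≤1 S) (selectedCount-fits n k heads))
                       (descSums-maxContent≤ 1 1 (selectedCount-fits n k tails)) ⟩
      descSum 0ℤ q₁ + descSum (+ r) q₂ ∎))
      where open ℤₚ.≤-Reasoning

  infix 4 _≈ᵘ_÷_ _≈_÷_

  record _≈ᵘ_÷_ (p : ℚᵘ) (a b : ℤ) : Set where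
    constructor cross
    field cross-eq : ↥ p * b ≡ a * ↧ p

  record _≈_÷_ (x : ℚ) (a b : ℤ) : Set where
    constructor viaᵘ
    field unnormalised : toℚᵘ x ≈ᵘ a ÷ b

  ≈ᵘ-resp-≃ : ∀ {p q a b} → p ℚᵘ.≃ q → q ≈ᵘ a ÷ b → p ≈ᵘ a ÷ b
  ≈ᵘ-resp-≃ {mkℚᵘ P dp} {mkℚᵘ Q dq} {a} {b} (*≡* P≃Q) (cross Q≈) =
    cross (ℤₚ.*-cancelʳ-≡ (P * b) (a * + suc dp) (+ suc dq) (begin
    P * b * + suc dq          ≡⟨ swap P b (+ suc dq) ⟩
    P * + suc dq * b          ≡⟨ cong (_* b) P≃Q ⟩
    Q * + suc dp * b          ≡⟨ swap Q (+ suc dp) b ⟩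
    Q * b * + suc dp          ≡⟨ cong (_* + suc dp) Q≈ ⟩
    a * + suc dq * + suc dp   ≡⟨ swap a (+ suc dq) (+ suc dp) ⟩
    a * + suc dp * + suc dq   ∎))
    where
    open ≡-Reasoning
    swap : ∀ x y z → x * y * z ≡ x * z * y
    swap = solve-∀

  ≈ᵘ-+ : ∀ {p q a b c d} → p ≈ᵘ a ÷ b → q ≈ᵘ c ÷ d → p ℚᵘ.+ q ≈ᵘ a * d + c * b ÷ b * d
  ≈ᵘ-+ {mkℚᵘ P dp} {mkℚᵘ Q dq} {a} {b} {c} {d} (cross p≈) (cross q≈) = cross (begin
    (P * + suc dq + Q * + suc dp) * (b * d)                     ≡⟨ regroup P Q (+ suc dp) (+ suc dq) b d ⟩
    (P * b) * (+ suc dq * d) + (Q * d) * (+ suc dp * b)         ≡⟨ cong₂ (λ x y → x * (+ suc dq * d) + y * (+ suc dp * b)) p≈ q≈ ⟩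
    (a * + suc dp) * (+ suc dq * d) + (c * + suc dq) * (+ suc dp * b) ≡⟨ collect a c (+ suc dp) (+ suc dq) b d ⟩
    (a * d + c * b) * (+ suc dp * + suc dq)                     ∎)
    where
    open ≡-Reasoning
    regroup : ∀ P Q Dp Dq b d → (P * Dq + Q * Dp) * (b * d) ≡ (P * b) * (Dq * d) + (Q * d) * (Dp * b)
    regroup = solve-∀
    collect : ∀ a c Dp Dq b d → (a * Dp) * (Dq * d) + (c * Dq) * (Dp * b) ≡ (a * d + c * b) * (Dp * Dq)
    collect = solve-∀

  ≈ᵘ-* : ∀ {p q a b c d} → p ≈ᵘ a ÷ b → q ≈ᵘ c ÷ d → p ℚᵘ.* q ≈ᵘ a * c ÷ b * d
  ≈ᵘ-* {mkℚᵘ P dp} {mkℚᵘ Q dq} {a} {b} {c} {d} (cross p≈) (cross q≈) = cross (begin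
    (P * Q) * (b * d)                ≡⟨ interchange P Q b d ⟩
    (P * b) * (Q * d)                ≡⟨ cong₂ _*_ p≈ q≈ ⟩
    (a * + suc dp) * (c * + suc dq)  ≡⟨ interchange a (+ suc dp) c (+ suc dq) ⟩
    (a * c) * (+ suc dp * + suc dq)  ∎)
    where
    open ≡-Reasoning
    interchange : ∀ w x y z → (w * x) * (y * z) ≡ (w * y) * (x * z)
    interchange = solve-∀

  ≈ᵘ-neg : ∀ {p a b} → p ≈ᵘ a ÷ b → ℚᵘ.- p ≈ᵘ - a ÷ b
  ≈ᵘ-neg {mkℚᵘ P dp} {a} {b} (cross p≈) =
    cross (trans (sym (ℤₚ.neg-distribˡ-* P b)) (trans (cong -_ p≈) (ℤₚ.neg-distribˡ-* a (+ suc dp))))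

  ≈-+ : ∀ {x y a b c d} → x ≈ a ÷ b → y ≈ c ÷ d → x ℚ.+ y ≈ a * d + c * b ÷ b * d
  ≈-+ {x} {y} (viaᵘ x≈) (viaᵘ y≈) = viaᵘ (≈ᵘ-resp-≃ (ℚₚ.toℚᵘ-homo-+ x y) (≈ᵘ-+ x≈ y≈))

  ≈-* : ∀ {x y a b c d} → x ≈ a ÷ b → y ≈ c ÷ d → x ℚ.* y ≈ a * c ÷ b * d
  ≈-* {x} {y} (viaᵘ x≈) (viaᵘ y≈) = viaᵘ (≈ᵘ-resp-≃ (ℚₚ.toℚᵘ-homo-* x y) (≈ᵘ-* x≈ y≈))

  ≈-neg : ∀ {x a b} → x ≈ a ÷ b → ℚ.- x ≈ - a ÷ b
  ≈-neg {x} (viaᵘ x≈) = viaᵘ (≈ᵘ-resp-≃ (ℚₚ.toℚᵘ-homo‿- x) (≈ᵘ-neg x≈))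

  1≈ : ℚ.1ℚ ≈ 1ℤ ÷ 1ℤ
  1≈ = viaᵘ (cross refl)

  frac≈ : ∀ a d → 1 ℕ.≤ d → frac a d ≈ a ÷ + d
  frac≈ a (suc d) _ = viaᵘ (≈ᵘ-resp-≃ (ℚₚ.toℚᵘ-fromℚᵘ (mkℚᵘ a d)) (cross refl))

  ≈-rescale : ∀ {x a b a′ b′} → x ≈ a ÷ b → 0ℤ < b → a * b′ ≡ a′ * b → x ≈ a′ ÷ b′
  ≈-rescale {x} {a} {+[1+ b ]} {a′} {b′} (viaᵘ (cross x≈)) _ a·b′≡a′·b =
    viaᵘ (cross (ℤₚ.*-cancelʳ-≡ _ _ +[1+ b ] (begin
    ↥ toℚᵘ x * b′ * +[1+ b ]   ≡⟨ swap (↥ toℚᵘ x) b′ +[1+ b ] ⟩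
    ↥ toℚᵘ x * +[1+ b ] * b′   ≡⟨ cong (_* b′) x≈ ⟩
    a * ↧ toℚᵘ x * b′          ≡⟨ swap a (↧ toℚᵘ x) b′ ⟩
    a * b′ * ↧ toℚᵘ x          ≡⟨ cong (_* ↧ toℚᵘ x) a·b′≡a′·b ⟩
    a′ * +[1+ b ] * ↧ toℚᵘ x   ≡⟨ swap a′ +[1+ b ] (↧ toℚᵘ x) ⟩
    a′ * ↧ toℚᵘ x * +[1+ b ]   ∎)))
    where
    open ≡-Reasoning
    swap : ∀ x y z → x * y * z ≡ x * z * y
    swap = solve-∀

  ≈-rescale {b = + zero} _ (+<+ ()) _

  ≈-≤ : ∀ {x y a b c d} → x ≈ a ÷ b → y ≈ c ÷ d → 0ℤ < b → 0ℤ < d → a * d ≤ c * b → x ℚ.≤ y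
  ≈-≤ {x} {y} {a} {+[1+ b ]} {c} {+[1+ d ]} (viaᵘ (cross x≈)) (viaᵘ (cross y≈)) _ _ ad≤cb =
    ℚₚ.toℚᵘ-cancel-≤ (*≤* (ℤₚ.*-cancelʳ-≤-pos _ _ (+[1+ b ] * +[1+ d ]) (begin
    X * ↧ toℚᵘ y * (+[1+ b ] * +[1+ d ])     ≡⟨ regroup X (↧ toℚᵘ y) +[1+ b ] +[1+ d ] ⟩
    (X * +[1+ b ]) * (↧ toℚᵘ y * +[1+ d ])   ≡⟨ cong (_* (↧ toℚᵘ y * +[1+ d ])) x≈ ⟩
    (a * ↧ toℚᵘ x) * (↧ toℚᵘ y * +[1+ d ])   ≡⟨ regroup′ a (↧ toℚᵘ x) (↧ toℚᵘ y) +[1+ d ] ⟩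
    (a * +[1+ d ]) * (↧ toℚᵘ x * ↧ toℚᵘ y)   ≤⟨ ℤₚ.*-monoʳ-≤-nonNeg (↧ toℚᵘ x * ↧ toℚᵘ y) ad≤cb ⟩
    (c * +[1+ b ]) * (↧ toℚᵘ x * ↧ toℚᵘ y)   ≡⟨ regroup′′ c +[1+ b ] (↧ toℚᵘ x) (↧ toℚᵘ y) ⟩
    (c * ↧ toℚᵘ y) * (↧ toℚᵘ x * +[1+ b ])   ≡⟨ cong (_* (↧ toℚᵘ x * +[1+ b ])) y≈ ⟨
    (Y * +[1+ d ]) * (↧ toℚᵘ x * +[1+ b ])   ≡⟨ regroup‴ Y +[1+ d ] (↧ toℚᵘ x) +[1+ b ] ⟩
    Y * ↧ toℚᵘ x * (+[1+ b ] * +[1+ d ])     ∎)))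
    where
    open ℤₚ.≤-Reasoning
    X Y : ℤ
    X = ↥ toℚᵘ x
    Y = ↥ toℚᵘ y
    regroup : ∀ X Dy B D → X * Dy * (B * D) ≡ (X * B) * (Dy * D)
    regroup = solve-∀
    regroup′ : ∀ a Dx Dy D → (a * Dx) * (Dy * D) ≡ (a * D) * (Dx * Dy)
    regroup′ = solve-∀
    regroup′′ : ∀ c B Dx Dy → (c * B) * (Dx * Dy) ≡ (c * Dy) * (Dx * B)
    regroup′′ = solve-∀
    regroup‴ : ∀ Y D Dx B → (Y * D) * (Dx * B) ≡ Y * Dx * (B * D)
    regroup‴ = solve-∀

  ≈-≤ {b = + zero}                 _ _ (+<+ ()) _        _
  ≈-≤ {b = +[1+ _ ]} {d = + zero} _ _ _        (+<+ ()) _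

  ∣-∣-≤ : ∀ {x y} → x ℚ.≤ y → ℚ.- x ℚ.≤ y → ℚ.∣ x ∣ ℚ.≤ y
  ∣-∣-≤ {x} {y} x≤y -x≤y with ℚₚ.∣p∣≡p∨∣p∣≡-p x
  ... | inj₁ ∣x∣≡x  = subst (ℚ._≤ y) (sym ∣x∣≡x) x≤y
  ... | inj₂ ∣x∣≡-x = subst (ℚ._≤ y) (sym ∣x∣≡-x) -x≤y

  frac<nat⇒< : ∀ x d a → frac (+ x) (suc d) ℚ.< nat a → x ℕ.< suc d ℕ.* a
  frac<nat⇒< x d a x/d<a = ℕₚ.≰⇒> λ d·a≤x → ℚₚ.<-irrefl refl (ℚₚ.<-≤-trans x/d<a
    (≈-≤ (frac≈ (+ a) 1 (s≤s z≤n)) (frac≈ (+ x) (suc d) (s≤s z≤n)) (0<+suc 0) (0<+suc d)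
      (subst₂ _≤_ (trans (cong +_ (ℕₚ.*-comm (suc d) a)) (ℤₚ.pos-* a (suc d))) (sym (ℤₚ.*-identityʳ (+ x)))
        (+≤+ d·a≤x))))

  6n/10<a⇒2b+a≤a² : ∀ {a b n} → a ℕ.+ b ≡ n → frac (+ (6 ℕ.* n)) 10 ℚ.< nat a → 2 ℕ.* b ℕ.+ a ℕ.≤ a ℕ.* a
  6n/10<a⇒2b+a≤a² {a} {b} refl 6n/10<a = 6[a+b]<10a⇒2b+a≤a² a b (frac<nat⇒< _ 9 a 6n/10<a)

  module Eigenvalue (n' k : ℕ) (1≤n' : 1 ℕ.≤ n') (1≤k : 1 ℕ.≤ k) (k≤n : k ℕ.≤ suc n') where

    n M : ℕ
    n = suc n'
    M = 2 ℕ.* n ℕ.∸ (k ℕ.+ 1)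

    T : ℤ
    T = descSum (+ n') k

    k+1<2n : k ℕ.+ 1 ℕ.< 2 ℕ.* n
    k+1<2n = begin-strict
      k ℕ.+ 1          ≤⟨ ℕₚ.+-monoˡ-≤ 1 k≤n ⟩
      n ℕ.+ 1          <⟨ ℕₚ.+-monoʳ-< n (s≤s 1≤n') ⟩
      n ℕ.+ n          ≡⟨ cong (n ℕ.+_) (ℕₚ.+-identityʳ n) ⟨
      2 ℕ.* n          ∎
      where open ℕₚ.≤-Reasoning

    2T≡kM : + 2 * T ≡ + k * + M
    2T≡kM = begin
      + 2 * T                              ≡⟨ descSum-double (+ n') k ⟩
      + k * (+ 2 * + n' - + k + 1ℤ)        ≡⟨ cong (+ k *_) M≡ ⟨
      + k * + M                            ∎
      where
      open ≡-Reasoning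
      M≡ : + M ≡ + 2 * + n' - + k + 1ℤ
      M≡ = begin
        + M                                ≡⟨ ℤₚ.⊖-≥ (ℕₚ.<⇒≤ k+1<2n) ⟨
        (2 ℕ.* n) ℤ.⊖ (k ℕ.+ 1)            ≡⟨ ℤₚ.m-n≡m⊖n (2 ℕ.* n) (k ℕ.+ 1) ⟨
        + (2 ℕ.* n) - + (k ℕ.+ 1)          ≡⟨ cong (_- + (k ℕ.+ 1)) (ℤₚ.pos-* 2 n) ⟩
        + 2 * + n - (+ k + 1ℤ)             ≡⟨ regroup (+ n') (+ k) ⟩
        + 2 * + n' - + k + 1ℤ              ∎
        where
        regroup : ∀ N K → + 2 * (1ℤ + N) - (K + 1ℤ) ≡ + 2 * N - K + 1ℤ
        regroup = solve-∀

    0<n : 0ℤ < + n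
    0<n = 0<+suc n'

    0<T : 0ℤ < T
    0<T = ℤₚ.*-cancelˡ-<-nonNeg {i = 0ℤ} {j = T} (+ 2) (subst (0ℤ <_) (sym 2T≡kM)
      (0<-* (+<+ 1≤k) (+<+ (ℕₚ.m<n⇒0<n∸m k+1<2n))))

    -- As 2T = k(2n − k − 1), the weight 2(n − 1)/(nk(2n − k − 1)) in eig equals (n − 1)/(nT).
    eig≈ : ∀ S → eig n k S ≈ T + + n' * contentSum n k 1 S ÷ + n * T
    eig≈ S = ≈-rescale (≈-+ (frac≈ (+ 1) n (s≤s z≤n)) (≈-* weight≈ (frac≈ C 1 (s≤s z≤n))))
      (0<-* 0<n (0<-* (0<-* 0<n (0<-* (0<+suc 1) 0<T)) (0<+suc 0)))
      (regroup (+ n') T C)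
      where
      C : ℤ
      C = contentSum n k 1 S
      1≤nkM : 1 ℕ.≤ n ℕ.* k ℕ.* M
      1≤nkM = ℕₚ.*-mono-≤ (ℕₚ.*-mono-≤ {1} {n} (s≤s z≤n) 1≤k) (ℕₚ.m<n⇒0<n∸m k+1<2n)
      nkM≡ : + (n ℕ.* k ℕ.* M) ≡ + n * (+ 2 * T)
      nkM≡ = begin
        + (n ℕ.* k ℕ.* M)     ≡⟨ ℤₚ.pos-* (n ℕ.* k) M ⟩
        + (n ℕ.* k) * + M     ≡⟨ cong (_* + M) (ℤₚ.pos-* n k) ⟩
        + n * + k * + M       ≡⟨ ℤₚ.*-assoc (+ n) (+ k) (+ M) ⟩
        + n * (+ k * + M)     ≡⟨ cong (+ n *_) 2T≡kM ⟨
        + n * (+ 2 * T)       ∎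
        where open ≡-Reasoning
      weight≈ : frac (+ (2 ℕ.* n')) (n ℕ.* k ℕ.* M) ≈ + 2 * + n' ÷ + n * (+ 2 * T)
      weight≈ = subst₂ (frac (+ (2 ℕ.* n')) (n ℕ.* k ℕ.* M) ≈_÷_) (ℤₚ.pos-* 2 n') nkM≡ (frac≈ _ _ 1≤nkM)
      regroup : ∀ N′ T C → (+ 1 * ((1ℤ + N′) * (+ 2 * T) * + 1) + + 2 * N′ * C * (1ℤ + N′)) * ((1ℤ + N′) * T)
                         ≡ (T + N′ * C) * ((1ℤ + N′) * ((1ℤ + N′) * (+ 2 * T) * + 1))
      regroup = solve-∀

    bound≈ : ∀ a → bound n k a ≈ + n * + n * T - + n' * + k * (+ n - + a) * (+ a + 1ℤ) ÷ + n * + n * T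
    bound≈ a = ≈-rescale
      (≈-+ 1≈ (≈-neg (≈-* (≈-* weight≈ (frac≈ (+ n - + a) n (s≤s z≤n))) (frac≈ (+ (a ℕ.+ 1)) n (s≤s z≤n)))))
      (0<-* (0<+suc 0) (0<-* (0<-* (0<-* (0<+suc 1) 0<T) 0<n) 0<n))
      (regroup (+ n') (+ k) T (+ a))
      where
      weight≈ : frac (+ (2 ℕ.* n')) M ≈ + k * (+ 2 * + n') ÷ + 2 * T
      weight≈ = ≈-rescale (subst (λ a → frac (+ (2 ℕ.* n')) M ≈ a ÷ + M) (ℤₚ.pos-* 2 n') (frac≈ _ M (ℕₚ.m<n⇒0<n∸m k+1<2n)))
        (+<+ (ℕₚ.m<n⇒0<n∸m k+1<2n)) (trans (cong (+ 2 * + n' *_) 2T≡kM) (swap (+ 2 * + n') (+ k) (+ M)))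
        where
        swap : ∀ x y z → x * (y * z) ≡ y * x * z
        swap = solve-∀
      regroup : ∀ N′ K T A → (1ℤ * (+ 2 * T * (1ℤ + N′) * (1ℤ + N′)) + - (K * (+ 2 * N′) * ((1ℤ + N′) - A) * (A + 1ℤ)) * 1ℤ)
                             * ((1ℤ + N′) * (1ℤ + N′) * T)
                           ≡ ((1ℤ + N′) * (1ℤ + N′) * T - N′ * K * ((1ℤ + N′) - A) * (A + 1ℤ))
                             * (1ℤ * (+ 2 * T * (1ℤ + N′) * (1ℤ + N′)))
      regroup = solve-∀

    n-a≡b : ∀ {a b} → a ℕ.+ b ≡ n → + b ≡ + n - + a
    n-a≡b {a} {b} a+b≡n = trans (sym (cancel (+ a) (+ b))) (cong (λ m → + m - + a) a+b≡n)
      where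
      cancel : ∀ A B → A + B - A ≡ B
      cancel = solve-∀

    module _ (S : Tableau) where

      C : ℤ
      C = contentSum n k 1 S

      eig≤frac : ∀ a' → + n' * C ≤ + a' * T → eig n k S ℚ.≤ frac (+ suc a') n
      eig≤frac a' h = ≈-≤ (eig≈ S) (frac≈ (+ suc a') n (s≤s z≤n)) (0<-* 0<n 0<T) 0<n
        (≤-by (+ n * (+ a' * T - + n' * C)) (0≤-* (0≤+ n) (ℤₚ.i≤j⇒0≤j-i h)) (expand (+ n') T C (+ a')))
        where
        expand : ∀ N′ T C A′ → (1ℤ + A′) * ((1ℤ + N′) * T) ≡ (T + N′ * C) * (1ℤ + N′) + (1ℤ + N′) * (A′ * T - N′ * C)
        expand = solve-∀

      frac≤eig : ∀ m' → + n' * (- C) ≤ + m' * T → frac (+ 2 - + suc m') n ℚ.≤ eig n k S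
      frac≤eig m' h = ≈-≤ (frac≈ (+ 2 - + suc m') n (s≤s z≤n)) (eig≈ S) 0<n (0<-* 0<n 0<T)
        (≤-by (+ n * (+ m' * T - + n' * (- C))) (0≤-* (0≤+ n) (ℤₚ.i≤j⇒0≤j-i h)) (expand (+ n') T C (+ m')))
        where
        expand : ∀ N′ T C M′ →
          (T + N′ * C) * (1ℤ + N′) ≡ (+ 2 - (1ℤ + M′)) * ((1ℤ + N′) * T) + (1ℤ + N′) * (M′ * T - N′ * (- C))
        expand = solve-∀

      eig≤bound : ∀ a b → a ℕ.+ b ≡ n → + n * C + + k * + b * (+ a + 1ℤ) ≤ + n * T → eig n k S ℚ.≤ bound n k a
      eig≤bound a b a+b≡n h = ≈-≤ (eig≈ S) (bound≈ a) (0<-* 0<n 0<T) (0<-* (0<-* 0<n 0<n) 0<T)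
        (≤-by (+ n * + n' * T * (+ n * T - (+ n * C + + k * (+ n - + a) * (+ a + 1ℤ))))
          (0≤-* (0≤-* (0≤-* (0≤+ n) (0≤+ n')) (ℤₚ.<⇒≤ 0<T))
            (ℤₚ.i≤j⇒0≤j-i (subst (λ B → + n * C + + k * B * (+ a + 1ℤ) ≤ + n * T) (n-a≡b a+b≡n) h)))
          (expand (+ n') (+ k) T C (+ a)))
        where
        expand : ∀ N′ K T C A → let N = 1ℤ + N′ in
          (N * N * T - N′ * K * (N - A) * (A + 1ℤ)) * (N * T)
          ≡ (T + N′ * C) * (N * N * T) + N * N′ * T * (N * T - (N * C + K * (N - A) * (A + 1ℤ)))
        expand = solve-∀

      -eig≤bound : ∀ a b → a ℕ.+ b ≡ n → + n * (- C) + + k * + b * (+ a + 1ℤ) ≤ + n * T → ℚ.- eig n k S ℚ.≤ bound n k a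
      -eig≤bound a b a+b≡n h = ≈-≤ (≈-neg (eig≈ S)) (bound≈ a) (0<-* 0<n 0<T) (0<-* (0<-* 0<n 0<n) 0<T)
        (≤-by (+ n * T * (+ n' * (+ n * T - (+ n * (- C) + + k * (+ n - + a) * (+ a + 1ℤ))) + + 2 * + n * T))
          (0≤-* (0≤-* (0≤+ n) (ℤₚ.<⇒≤ 0<T))
            (0≤-+ (0≤-* (0≤+ n')
                    (ℤₚ.i≤j⇒0≤j-i (subst (λ B → + n * (- C) + + k * B * (+ a + 1ℤ) ≤ + n * T) (n-a≡b a+b≡n) h)))
                  (0≤-* (0≤-* (0≤+ 2) (0≤+ n)) (ℤₚ.<⇒≤ 0<T))))
          (expand (+ n') (+ k) T C (+ a)))
        where
        expand : ∀ N′ K T C A → let N = 1ℤ + N′ in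
          (N * N * T - N′ * K * (N - A) * (A + 1ℤ)) * (N * T)
          ≡ - (T + N′ * C) * (N * N * T) + N * T * (N′ * (N * T - (N * (- C) + K * (N - A) * (A + 1ℤ))) + + 2 * N * T)
        expand = solve-∀

open import Defs
open import Data.Nat as ℕ using (ℕ; _≤_; zero; suc; s≤s)
open import Data.Integer as ℤ using (+_)
import Data.Rational as ℚ
open import Data.List using (List; []; _∷_; length; map)
import Data.List.Properties as Listₚ
open import Data.Nat.ListAction using (sum)
open import Data.List.Relation.Unary.All using (All; _∷_)
open import Data.List.Relation.Unary.Linked using (Linked)
open import Data.Product using (_×_; _,_)
open import Relation.Binary.PropositionalEquality using (_≡_; refl; sym; trans; cong; subst)
open Bounds

lemma4p3 : (n k m λ₁ : ℕ) (rest : List ℕ) (S : Tableau) →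
    2 ≤ n → 1 ≤ k → k ≤ n →
    IsPartition n (λ₁ ∷ rest) → length (λ₁ ∷ rest) ≡ m →
    IsSYT n (λ₁ ∷ rest) S →
    ((frac (+ 2 ℤ.- + m) n ℚ.≤ eig n k S) × (eig n k S ℚ.≤ frac (+ λ₁) n))
    × ((frac (+ (6 ℕ.* n)) 10 ℚ.< nat λ₁ → ℚ.∣ eig n k S ∣ ℚ.≤ bound n k λ₁)
    × (frac (+ (6 ℕ.* n)) 10 ℚ.< nat m → ℚ.∣ eig n k S ∣ ℚ.≤ bound n k m))
lemma4p3 _ _ _ zero _ _ _ _ _ ((() ∷ _) , _) _ _
lemma4p3 _ _ _ _ _ [] _ _ _ _ _ (() , _)
lemma4p3 (suc n') k .(suc (length rest)) (suc a') rest S@(row ∷ S₂) (s≤s 1≤n') 1≤k k≤n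
         (pos , ws↘ , n≡) refl (shape , perm , _ , _) =
  ( frac≤eig S (length rest) (-[n-1]C≤[m-1]T S shape ws↘ refl n≡ k≡)
  , eig≤frac S a' ([n-1]C≤[λ₁-1]T S shape ws↘ n≡ k≡))
  , (λ λ₁-large → ∣-∣-≤
      (eig≤bound S (suc a') (sum rest) n≡ (firstRow-bound row S₂ shape n≡ k≡))
      (-eig≤bound S (suc a') (sum rest) n≡
        (firstRow-bound′ row S₂ shape n≡ k≡ ws↘ (6n/10<a⇒2b+a≤a² n≡ λ₁-large))))
  , (λ m-large → ∣-∣-≤
      (eig≤bound S m r m+r≡n (firstColumn-bound′ (6n/10<a⇒2b+a≤a² m+r≡n m-large)))
      (-eig≤bound S m r m+r≡n firstColumn-bound))
  where
  open Eigenvalue n' k 1≤n' 1≤k k≤n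
  m : ℕ
  m = suc (length rest)
  k≡ : sum (map (selectedCount (suc n') k) S) ≡ k
  k≡ = selectedCount-total S k≤n perm
  open ColumnSplit S (subst (All (1 ≤_)) (sym shape) pos) (subst (Linked ℕ._≥_) (sym shape) ws↘)
    (trans (sym (Listₚ.length-map length S)) (cong length shape)) (trans (cong sum shape) n≡) k≡
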